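{- Let $a,b$ be relatively prime integers such that the Lucas sequences below are non-degenerate, and suppose $a>0$ and $\Delta=a^2+4b>0$. Let $m,n\geq 3$ be integers, $d=\gcd(m,n)$. Then: (i) $\tau(U_mV_n)=2[m,n]$ if $\nu_2(m)\leq \nu_2(n)$, and $\tau(U_mV_n)=[m,n]V_d$ if $\nu_2(m)>\nu_2(n)$. (ii) $\tau(U_mU_n)=[m,n]U_d$. (iii) $\tau(V_mV_n)=[m,n]\gcd(V_m,V_n)$ if ($2\nmid b$, $2\mid a$, $2\mid d$) or ($2\nmid b$, $2\nmid a$, $3\mid d$) or ($2\nmid b$, $2\mid a$, $2\nmid d$, $\nu_2(m)\neq\nu_2(n)$); and $\tau(V_mV_n)=2[m,n]\gcd(V_m,V_n)$ if $2\mid b$ or ($2\nmid b$, $2\nmid a$, $3\nmid d$) or ($2\nmid b$, $2\mid a$, $2\nmid d$, $\nu_2(m)=\nu_2(n)$).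
   Context: For relatively prime integers $a,b$, the first and second Lucas sequences are defined by $U_0=0$, $U_1=1$, $U_{n+2}=aU_{n+1}+bU_n$ and $V_0=2$, $V_1=a$, $V_{n+2}=aV_{n+1}+bV_n$ ($n\ge 0$). Non-degenerate means $b\neq 0$ and $\alpha/\beta$ is not a root of unity, where $\alpha,\beta$ are the roots of $x^2-ax-b=0$. For a positive integer $k$ with $\gcd(k,b)=1$, $\tau(k)$ (the order of appearance) is the smallest positive integer $t$ with $k\mid U_t$. $[m,n]$ denotes the least common multiple and $\nu_p$ the $p$-adic valuation. -}

module Defs where

open import Data.Nat as ℕ using (ℕ; zero; suc; _∸_)
open import Data.Nat.DivMod using (_/_; _%_)
open import Data.Integer as ℤ using (ℤ; +_; _+_; _*_; _-_; _<_; _>_)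
open import Data.Integer.Divisibility using (_∣_)
open import Data.Integer.Coprimality using (Coprime)
open import Data.Product using (_×_; Σ)
open import Relation.Nullary using (¬_)
open import Relation.Binary.PropositionalEquality using (_≡_; _≢_)

U : ℤ → ℤ → ℕ → ℤ
U a b zero = + 0
U a b (suc zero) = + 1
U a b (suc (suc n)) = a * U a b (suc n) + b * U a b n

V : ℤ → ℤ → ℕ → ℤ
V a b zero = + 2
V a b (suc zero) = a
V a b (suc (suc n)) = a * V a b (suc n) + b * V a b n

Δ : ℤ → ℤ → ℤ
Δ a b = a * a + + 4 * b

-- Non-degeneracy: b ≠ 0 and α/β is not a root of unity, where α, β are the
-- roots of x² - a x - b.  Expressed without leaving ℤ: α ≠ β (i.e. Δ ≠ 0)
-- and α^k ≠ β^k for every k ≥ 1; since α ≠ β, α^k = β^k iff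
-- U_k = (α^k - β^k)/(α - β) = 0.
NonDegenerate : ℤ → ℤ → Set
NonDegenerate a b =
  (b ≢ + 0) × (Δ a b ≢ + 0) × (∀ k → k ℕ.≥ 1 → U a b k ≢ + 0)

IsOrderOfAppearance : ℤ → ℤ → ℤ → ℕ → Set
IsOrderOfAppearance a b k t =
  (t ℕ.≥ 1) × (k ∣ U a b t) × (∀ s → s ℕ.≥ 1 → s ℕ.< t → ¬ (k ∣ U a b s))

τ≡ : ℤ → ℤ → ℤ → ℤ → Set
τ≡ a b k y = Σ ℕ (λ t → IsOrderOfAppearance a b k t × + t ≡ y)

-- 2-adic valuation of a natural number (ν₂ 0 = 0 by convention; only used for n ≥ 3)
ν₂-fuel : ℕ → ℕ → ℕ
ν₂-fuel zero n = 0
ν₂-fuel (suc f) zero = 0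
ν₂-fuel (suc f) (suc n) with (suc n) % 2
... | zero = suc (ν₂-fuel f (suc n / 2))
... | suc _ = 0

ν₂ : ℕ → ℕ
ν₂ n = ν₂-fuel n n

{-# OPTIONS --safe #-}
-- For a > 0 and Δ > 0 the sequences U and V are positive and grow fast enough (V at least
-- doubles every two steps) that, for m, n ≥ 3, U_m ∣ U_s forces m ∣ s and V_n ∣ U_s forces
-- 2n ∣ s.  The rest is divisibility structure: U is a strong divisibility sequence,
-- U_2n = U_n V_n, V_h ∣ V_hx for odd x, gcd (U_n, V_n) ∣ 2, and the lifting lemma
-- "if M ∣ U_t then M U_t ∣ U_qt iff M ∣ q", which comes from U_qt ≡ q U_t U_(t+1)^(q-1)
-- (mod U_t²) and gcd (U_t, U_(t+1)) = 1.  Writing m = d m′, n = d n′ with m′, n′ coprime,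
-- each order of appearance is first shown to be a multiple of [m, n] (or of 2 [m, n] when a
-- V-factor is present); lifting at m and n (or 2m and 2n) then pins down the remaining
-- factor.  The parity hypotheses of (iii) decide whether gcd (V_m, V_n) and the gcds
-- between V_m, V_n and U_n, U_m are 1 or 2.
module Submission where

open import Defs
open import Data.Nat as ℕ using (ℕ; zero; suc; s≤s; z≤n)
import Data.Nat.Properties as ℕP
open import Data.Integer using (ℤ; +_; -[1+_]; ∣_∣)
import Data.Integer as ℤ
import Data.Integer.Properties as ℤP
import Data.Integer.Coprimality as ℤC
open import Data.Product using (_×_; _,_; Σ; proj₁; proj₂)
open import Data.Sum using (_⊎_; inj₁; inj₂; swap)
open import Relation.Binary.PropositionalEquality
open import Relation.Nullary using (¬_; Dec; yes; no; contradiction)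
open import Function.Base using (_∘_)
open import Function.Bundles using (_⇔_; mk⇔; Equivalence)

module SignedCoprimality where
  open import Data.Integer using (_*_; _^_)
  open import Data.Integer.Divisibility.Signed
  import Data.Nat.Divisibility as ℕD

  Coprimeˢ : ℤ → ℤ → Set
  Coprimeˢ x y = ∀ {d} → d ∣ x → d ∣ y → d ∣ + 1

  coprime⇒coprimeˢ : ∀ {x y} → ℤC.Coprime x y → Coprimeˢ x y
  coprime⇒coprimeˢ c p q =
    ∣ᵤ⇒∣ (ℕD.divides 1 (sym (trans (ℕP.*-identityˡ _) (c (∣⇒∣ᵤ p , ∣⇒∣ᵤ q)))))

  coprimeˢ-divisor : ∀ {x y z} → Coprimeˢ x y → x ∣ y * z → x ∣ z
  coprimeˢ-divisor {x} {y} {z} c h = ∣ᵤ⇒∣ (ℤC.coprime-divisor x y z coprime (∣⇒∣ᵤ h))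
    where
    coprime : ℤC.Coprime x y
    coprime {i} (p , q) = ℕD.∣1⇒≡1 (∣⇒∣ᵤ (c {+ i} (∣ᵤ⇒∣ p) (∣ᵤ⇒∣ q)))

  coprimeˢ-∣ˡ : ∀ {x y e} → e ∣ x → Coprimeˢ x y → Coprimeˢ e y
  coprimeˢ-∣ˡ e∣x c p q = c (∣-trans p e∣x) q

  coprimeˢ-^ʳ : ∀ {x y} j → Coprimeˢ x y → Coprimeˢ x (y ^ j)
  coprimeˢ-^ʳ zero    c p q = q
  coprimeˢ-^ʳ (suc j) c p q = coprimeˢ-^ʳ j c p (coprimeˢ-divisor (coprimeˢ-∣ˡ p c) q)

module NatDivisibility where
  open import Data.Nat using (_+_; _*_; _≤_; NonZero)
  open import Data.Nat.DivMod using (_/_; _%_; m≡m%n+[m/n]*n; m%n<n)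
  open import Data.Nat.Divisibility
  open import Data.Nat.GCD using (gcd; gcd-greatest; c*gcd[m,n]≡gcd[cm,cn]; gcd[m,n]≡0⇒m≡0)
  open import Data.Nat.Coprimality using (Coprime; coprime-divisor)
  open import Data.Nat.Primality using (prime?; euclidsLemma)
  open import Data.Nat.Tactic.RingSolver using (solve-∀)
  open import Relation.Nullary.Decidable using (from-yes)

  1≤⇒nonZero : ∀ {n} → 1 ≤ n → NonZero n
  1≤⇒nonZero {suc n} _ = _

  1≤* : ∀ {m n} → 1 ≤ m → 1 ≤ n → 1 ≤ m * n
  1≤* {suc m} {suc n} _ _ = s≤s z≤n

  m∣n⇒m≤n : ∀ {m n} → 1 ≤ n → m ∣ n → m ≤ n
  m∣n⇒m≤n {m} {suc n} _ = ∣⇒≤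

  gcd-positive : ∀ m n → 1 ≤ m → 1 ≤ gcd m n
  gcd-positive m n 1≤m = ℕP.n≢0⇒n>0 (λ g≡0 → contradiction (subst (1 ≤_) (gcd[m,n]≡0⇒m≡0 g≡0) 1≤m) λ ())

  gcd[mk,nk]≡gcd[m,n]k : ∀ m n k → gcd (m * k) (n * k) ≡ gcd m n * k
  gcd[mk,nk]≡gcd[m,n]k m n k = trans (cong₂ gcd (ℕP.*-comm m k) (ℕP.*-comm n k))
    (trans (sym (c*gcd[m,n]≡gcd[cm,cn] k m n)) (ℕP.*-comm k (gcd m n)))

  m∣nk⇒m∣gcd[m,n]k : ∀ m n k → m ∣ n * k → m ∣ gcd m n * k
  m∣nk⇒m∣gcd[m,n]k m n k h = subst (m ∣_) (gcd[mk,nk]≡gcd[m,n]k m n k) (gcd-greatest (m∣m*n k) h)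

  m∣k∧n∣k⇒mn∣k*gcd[m,n] : ∀ {m n k} → m ∣ k → n ∣ k → m * n ∣ k * gcd m n
  m∣k∧n∣k⇒mn∣k*gcd[m,n] {m} {n} {k} m∣k n∣k = subst (m * n ∣_) (sym (c*gcd[m,n]≡gcd[cm,cn] k m n))
    (gcd-greatest (subst (m * n ∣_) (ℕP.*-comm m k) (*-monoʳ-∣ m n∣k)) (*-monoˡ-∣ n m∣k))

  ∣2⇒≡1⊎≡2 : ∀ {d} → d ∣ 2 → d ≡ 1 ⊎ d ≡ 2
  ∣2⇒≡1⊎≡2 {d} h with ∣⇒≤ h
  ∣2⇒≡1⊎≡2 {zero}                h | _ = contradiction (0∣⇒≡0 h) λ ()
  ∣2⇒≡1⊎≡2 {suc zero}            h | _ = inj₁ refl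
  ∣2⇒≡1⊎≡2 {suc (suc zero)}      h | _ = inj₂ refl
  ∣2⇒≡1⊎≡2 {suc (suc (suc d))}   h | s≤s (s≤s ())

  ∣3⇒≡1⊎≡3 : ∀ {d} → d ∣ 3 → d ≡ 1 ⊎ d ≡ 3
  ∣3⇒≡1⊎≡3 {d} h with ∣⇒≤ h
  ∣3⇒≡1⊎≡3 {zero}                    h | _ = contradiction (0∣⇒≡0 h) λ ()
  ∣3⇒≡1⊎≡3 {suc zero}                h | _ = inj₁ refl
  ∣3⇒≡1⊎≡3 {suc (suc zero)}          (divides (suc (suc zero)) ()) | _
  ∣3⇒≡1⊎≡3 {suc (suc (suc zero))}    h | _ = inj₂ refl
  ∣3⇒≡1⊎≡3 {suc (suc (suc (suc d)))} h | s≤s (s≤s (s≤s ()))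

  ∣2∧odd⇒≡1 : ∀ {d} → d ∣ 2 → ¬ (2 ∣ d) → d ≡ 1
  ∣2∧odd⇒≡1 h odd with ∣2⇒≡1⊎≡2 h
  ... | inj₁ d≡1 = d≡1
  ... | inj₂ refl = contradiction ∣-refl odd

  ∣2∧even⇒≡2 : ∀ {d} → d ∣ 2 → 2 ∣ d → d ≡ 2
  ∣2∧even⇒≡2 h even with ∣2⇒≡1⊎≡2 h
  ... | inj₁ refl = contradiction (∣1⇒≡1 even) λ ()
  ... | inj₂ d≡2 = d≡2

  ∣∧≢⇒2*≤ : ∀ {d n} → 1 ≤ n → d ∣ n → d ≢ n → 2 * d ≤ n
  ∣∧≢⇒2*≤ {d} 1≤n (divides zero refl)          _   = contradiction 1≤n λ ()
  ∣∧≢⇒2*≤ {d} _   (divides (suc zero) refl)    d≢n = contradiction (sym (ℕP.+-identityʳ d)) d≢n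
  ∣∧≢⇒2*≤ {d} _   (divides (suc (suc q)) refl) _   = ℕP.*-monoˡ-≤ d {2} {suc (suc q)} (s≤s (s≤s z≤n))

  odd*odd : ∀ {m n} → ¬ (2 ∣ m) → ¬ (2 ∣ n) → ¬ (2 ∣ m * n)
  odd*odd {m} {n} m-odd n-odd h with euclidsLemma m n (from-yes (prime? 2)) h
  ... | inj₁ 2∣m = m-odd 2∣m
  ... | inj₂ 2∣n = n-odd 2∣n

  odd⇒h*x≡h+[x/2]*2h : ∀ h x → ¬ (2 ∣ x) → h * x ≡ h + x / 2 * (h + h)
  odd⇒h*x≡h+[x/2]*2h h x x-odd = trans (cong (h *_) x≡1+[x/2]*2) (expand (x / 2) h)
    where
    x%2≡1 : x % 2 ≡ 1
    x%2≡1 with x % 2 | m%n<n x 2 | (λ (e : x % 2 ≡ 0) → x-odd (m%n≡0⇒n∣m x 2 e))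
    ... | zero        | _               | x-even = contradiction refl x-even
    ... | suc zero    | _               | _      = refl
    ... | suc (suc _) | s≤s (s≤s ())    | _
    x≡1+[x/2]*2 : x ≡ 1 + x / 2 * 2
    x≡1+[x/2]*2 = trans (m≡m%n+[m/n]*n x 2) (cong (_+ x / 2 * 2) x%2≡1)
    expand : ∀ q h → h * (1 + q * 2) ≡ h + q * (h + h)
    expand = solve-∀

  odd-coprime-2 : ∀ {x} → ¬ (2 ∣ x) → Coprime x 2
  odd-coprime-2 x-odd (p , q) with ∣2⇒≡1⊎≡2 q
  ... | inj₁ d≡1 = d≡1
  ... | inj₂ refl = contradiction p x-odd

  odd∣2n⇒∣n : ∀ {x y} → ¬ (2 ∣ x) → x ∣ 2 * y → x ∣ y
  odd∣2n⇒∣n x-odd = coprime-divisor (odd-coprime-2 x-odd)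

module TwoAdicValuation where
  open import Data.Nat using (_+_; _*_; _≤_; _<_)
  open import Data.Nat.DivMod using (_/_; _%_; m*n/n≡m; m*n%n≡0; m/n<m)
  open import Data.Nat.Divisibility using (_∣_; divides; _∣?_; _∣0; m%n≡0⇒n∣m)
  open import Data.Nat.Induction using (<-rec)
  open NatDivisibility using (1≤*; odd*odd)
  open ≡-Reasoning

  ν₂-fuel-irrelevant : ∀ f g n → n ≤ f → n ≤ g → ν₂-fuel f n ≡ ν₂-fuel g n
  ν₂-fuel-irrelevant zero    zero    zero    _       _       = refl
  ν₂-fuel-irrelevant zero    (suc g) zero    _       _       = refl
  ν₂-fuel-irrelevant (suc f) zero    zero    _       _       = refl
  ν₂-fuel-irrelevant (suc f) (suc g) zero    _       _       = refl
  ν₂-fuel-irrelevant (suc f) (suc g) (suc n) (s≤s p) (s≤s q) with suc n % 2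
  ... | zero  = cong suc (ν₂-fuel-irrelevant f g (suc n / 2) (ℕP.≤-trans half p) (ℕP.≤-trans half q))
    where
    half : suc n / 2 ≤ n
    half = ℕP.≤-pred (m/n<m (suc n) 2 (s≤s (s≤s z≤n)))
  ... | suc _ = refl

  ν₂[2n]≡1+ν₂[n] : ∀ n → 1 ≤ n → ν₂ (2 * n) ≡ suc (ν₂ n)
  ν₂[2n]≡1+ν₂[n] (suc k) _ = begin
    ν₂-fuel (suc f) (suc f)             ≡⟨ even-step (trans (cong (_% 2) (ℕP.*-comm 2 (suc k))) (m*n%n≡0 (suc k) 2)) ⟩
    suc (ν₂-fuel f (suc f / 2))         ≡⟨ cong (λ x → suc (ν₂-fuel f x)) half ⟩
    suc (ν₂-fuel f (suc k))             ≡⟨ cong suc (ν₂-fuel-irrelevant f (suc k) (suc k) k<f ℕP.≤-refl) ⟩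
    suc (ν₂ (suc k))                    ∎
    where
    f = k + suc (k + 0)  -- 2 * suc k reduces to suc f
    half : suc f / 2 ≡ suc k
    half = trans (cong (_/ 2) (ℕP.*-comm 2 (suc k))) (m*n/n≡m (suc k) 2)
    k<f : suc k ≤ f
    k<f = subst (suc k ≤_) (sym (ℕP.+-suc k (k + 0))) (s≤s (ℕP.m≤m+n k _))
    even-step : suc f % 2 ≡ 0 → ν₂-fuel (suc f) (suc f) ≡ suc (ν₂-fuel f (suc f / 2))
    even-step e with suc f % 2 | e
    ... | zero | _ = refl

  ν₂[odd]≡0 : ∀ n → ¬ (2 ∣ n) → ν₂ n ≡ 0
  ν₂[odd]≡0 zero    n-odd = contradiction (2 ∣0) n-odd
  ν₂[odd]≡0 (suc n) n-odd with suc n % 2 in eq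
  ... | zero  = contradiction (m%n≡0⇒n∣m (suc n) 2 eq) n-odd
  ... | suc _ = refl

  private
    halve : ∀ {n} → 1 ≤ n → 2 ∣ n → Σ ℕ λ e → n ≡ 2 * e × 1 ≤ e × e < n
    halve {n} 1≤n (divides e refl) = e , ℕP.*-comm e 2 , 1≤e , e<2e
      where
      1≤e : 1 ≤ e
      1≤e = ℕP.n≢0⇒n>0 (λ e≡0 → contradiction (subst (λ w → 1 ≤ w * 2) e≡0 1≤n) λ ())
      e<2e : e < e * 2
      e<2e = subst (e <_) (trans (cong (λ w → e + w) (sym (ℕP.+-identityʳ e))) (ℕP.*-comm 2 e)) (ℕP.m<m+n e 1≤e)

  ν₂[even]≥1 : ∀ {n} → 1 ≤ n → 2 ∣ n → 1 ≤ ν₂ n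
  ν₂[even]≥1 1≤n 2∣n with halve 1≤n 2∣n
  ... | e , refl , 1≤e , _ = subst (1 ≤_) (sym (ν₂[2n]≡1+ν₂[n] e 1≤e)) (s≤s z≤n)

  private
    ν₂-odd* : ∀ x y → 1 ≤ x → ¬ (2 ∣ x) → 1 ≤ y → ν₂ (x * y) ≡ ν₂ y
    ν₂-odd* x y 1≤x x-odd = <-rec (λ y → 1 ≤ y → ν₂ (x * y) ≡ ν₂ y) step y
      where
      step : ∀ y → (∀ {z} → z < y → 1 ≤ z → ν₂ (x * z) ≡ ν₂ z) → 1 ≤ y → ν₂ (x * y) ≡ ν₂ y
      step y ih 1≤y with 2 ∣? y
      ... | no y-odd = trans (ν₂[odd]≡0 _ (odd*odd x-odd y-odd)) (sym (ν₂[odd]≡0 y y-odd))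
      ... | yes y-even with halve 1≤y y-even
      ...   | e , refl , 1≤e , e<y = begin
        ν₂ (x * (2 * e))     ≡⟨ cong ν₂ (ℕP.*-comm x (2 * e)) ⟩
        ν₂ (2 * e * x)       ≡⟨ cong ν₂ (ℕP.*-assoc 2 e x) ⟩
        ν₂ (2 * (e * x))     ≡⟨ cong (λ w → ν₂ (2 * w)) (ℕP.*-comm e x) ⟩
        ν₂ (2 * (x * e))     ≡⟨ ν₂[2n]≡1+ν₂[n] (x * e) (1≤* 1≤x 1≤e) ⟩
        suc (ν₂ (x * e))     ≡⟨ cong suc (ih e<y 1≤e) ⟩
        suc (ν₂ e)           ≡⟨ sym (ν₂[2n]≡1+ν₂[n] e 1≤e) ⟩
        ν₂ (2 * e)           ∎

  ν₂-* : ∀ x y → 1 ≤ x → 1 ≤ y → ν₂ (x * y) ≡ ν₂ x + ν₂ y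
  ν₂-* x y 1≤x 1≤y = <-rec (λ x → 1 ≤ x → ν₂ (x * y) ≡ ν₂ x + ν₂ y) step x 1≤x
    where
    step : ∀ x → (∀ {z} → z < x → 1 ≤ z → ν₂ (z * y) ≡ ν₂ z + ν₂ y) → 1 ≤ x → ν₂ (x * y) ≡ ν₂ x + ν₂ y
    step x ih 1≤x with 2 ∣? x
    ... | no x-odd = trans (ν₂-odd* x y 1≤x x-odd 1≤y) (cong (_+ ν₂ y) (sym (ν₂[odd]≡0 x x-odd)))
    ... | yes x-even with halve 1≤x x-even
    ...   | e , refl , 1≤e , e<x = begin
      ν₂ (2 * e * y)         ≡⟨ cong ν₂ (ℕP.*-assoc 2 e y) ⟩
      ν₂ (2 * (e * y))       ≡⟨ ν₂[2n]≡1+ν₂[n] (e * y) (1≤* 1≤e 1≤y) ⟩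
      suc (ν₂ (e * y))       ≡⟨ cong suc (ih e<x 1≤e) ⟩
      suc (ν₂ e) + ν₂ y      ≡⟨ cong (_+ ν₂ y) (sym (ν₂[2n]≡1+ν₂[n] e 1≤e)) ⟩
      ν₂ (2 * e) + ν₂ y      ∎

module GcdDecomposition where
  open import Data.Nat using (_+_; _*_; _≤_; _<_)
  open import Data.Nat.Divisibility using (_∣_; _∣?_; m∣n⇒n≡m*quotient; quotient)
  open import Data.Nat.GCD using (gcd; gcd[m,n]∣m; gcd[m,n]∣n)
  open import Data.Nat.LCM using (lcm; gcd*lcm)
  open import Data.Nat.Coprimality using (Coprime; gcd≡1⇒coprime)
  open import Data.Nat.Tactic.RingSolver using (solve-∀)
  open NatDivisibility using (1≤⇒nonZero; gcd-positive; gcd[mk,nk]≡gcd[m,n]k)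
  open TwoAdicValuation

  record Decomposition (m n : ℕ) : Set where
    field
      m′ n′     : ℕ
      m≡dm′     : m ≡ gcd m n * m′
      n≡dn′     : n ≡ gcd m n * n′
      coprime   : Coprime m′ n′
      lcm≡dm′n′ : lcm m n ≡ gcd m n * m′ * n′
      1≤d       : 1 ≤ gcd m n
      1≤m′      : 1 ≤ m′
      1≤n′      : 1 ≤ n′

  decompose : ∀ m n → 1 ≤ m → 1 ≤ n → Decomposition m n
  decompose m n 1≤m 1≤n = record
    { m′ = m′ ; n′ = n′ ; m≡dm′ = m≡dm′ ; n≡dn′ = n≡dn′
    ; coprime = gcd≡1⇒coprime gcd[m′,n′]≡1 ; lcm≡dm′n′ = lcm≡dm′n′
    ; 1≤d = 1≤d ; 1≤m′ = positive-cofactor 1≤m m≡dm′ ; 1≤n′ = positive-cofactor 1≤n n≡dn′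
    }
    where
    d = gcd m n
    1≤d : 1 ≤ d
    1≤d = gcd-positive m n 1≤m
    instance
      _ = 1≤⇒nonZero 1≤d
    m′ = quotient (gcd[m,n]∣m m n)
    n′ = quotient (gcd[m,n]∣n m n)
    m≡dm′ : m ≡ d * m′
    m≡dm′ = m∣n⇒n≡m*quotient (gcd[m,n]∣m m n)
    n≡dn′ : n ≡ d * n′
    n≡dn′ = m∣n⇒n≡m*quotient (gcd[m,n]∣n m n)
    gcd[m′,n′]≡1 : gcd m′ n′ ≡ 1
    gcd[m′,n′]≡1 = ℕP.*-cancelʳ-≡ (gcd m′ n′) 1 d
      (trans (sym (gcd[mk,nk]≡gcd[m,n]k m′ n′ d))
        (trans (cong₂ gcd (trans (ℕP.*-comm m′ d) (sym m≡dm′)) (trans (ℕP.*-comm n′ d) (sym n≡dn′)))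
               (sym (ℕP.*-identityˡ d))))
    regroup : ∀ d p q → d * p * (d * q) ≡ d * (d * p * q)
    regroup = solve-∀
    lcm≡dm′n′ : lcm m n ≡ d * m′ * n′
    lcm≡dm′n′ = ℕP.*-cancelˡ-≡ (lcm m n) (d * m′ * n′) d
      (trans (gcd*lcm m n) (trans (cong₂ _*_ m≡dm′ n≡dn′) (regroup d m′ n′)))
    positive-cofactor : ∀ {x y} → 1 ≤ x → x ≡ d * y → 1 ≤ y
    positive-cofactor {x} {zero}  1≤x x≡0 = contradiction (subst (1 ≤_) (trans x≡0 (ℕP.*-zeroʳ d)) 1≤x) λ ()
    positive-cofactor {x} {suc y} _   _   = s≤s z≤n

  module TwoAdicComparison {m n} (D : Decomposition m n) where
    open Decomposition D

    private
      ν₂[dk]≡ν₂[d] : ∀ {k} → 1 ≤ k → ¬ (2 ∣ k) → ν₂ (gcd m n * k) ≡ ν₂ (gcd m n)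
      ν₂[dk]≡ν₂[d] {k} 1≤k k-odd = trans (ν₂-* (gcd m n) k 1≤d 1≤k)
        (trans (cong (λ w → ν₂ (gcd m n) + w) (ν₂[odd]≡0 k k-odd)) (ℕP.+-identityʳ _))
      ν₂[d]<ν₂[dk] : ∀ {k} → 1 ≤ k → 2 ∣ k → ν₂ (gcd m n) < ν₂ (gcd m n * k)
      ν₂[d]<ν₂[dk] {k} 1≤k k-even = subst (ν₂ (gcd m n) <_) (sym (ν₂-* (gcd m n) k 1≤d 1≤k))
        (subst (_≤ ν₂ (gcd m n) + ν₂ k) (ℕP.+-comm (ν₂ (gcd m n)) 1)
               (ℕP.+-monoʳ-≤ (ν₂ (gcd m n)) (ν₂[even]≥1 1≤k k-even)))

    even-m′⇒odd-n′ : 2 ∣ m′ → ¬ (2 ∣ n′)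
    even-m′⇒odd-n′ p q = contradiction (coprime (p , q)) λ ()

    even-n′⇒odd-m′ : 2 ∣ n′ → ¬ (2 ∣ m′)
    even-n′⇒odd-m′ q p = contradiction (coprime (p , q)) λ ()

    odd-m′∧odd-n′⇒ν₂[m]≡ν₂[n] : ¬ (2 ∣ m′) → ¬ (2 ∣ n′) → ν₂ m ≡ ν₂ n
    odd-m′∧odd-n′⇒ν₂[m]≡ν₂[n] p q = trans (cong ν₂ m≡dm′)
      (trans (ν₂[dk]≡ν₂[d] 1≤m′ p) (sym (trans (cong ν₂ n≡dn′) (ν₂[dk]≡ν₂[d] 1≤n′ q))))

    even-m′⇒ν₂[n]<ν₂[m] : 2 ∣ m′ → ν₂ n < ν₂ m
    even-m′⇒ν₂[n]<ν₂[m] p = subst₂ _<_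
      (sym (trans (cong ν₂ n≡dn′) (ν₂[dk]≡ν₂[d] 1≤n′ (even-m′⇒odd-n′ p)))) (sym (cong ν₂ m≡dm′))
      (ν₂[d]<ν₂[dk] 1≤m′ p)

    even-n′⇒ν₂[m]<ν₂[n] : 2 ∣ n′ → ν₂ m < ν₂ n
    even-n′⇒ν₂[m]<ν₂[n] q = subst₂ _<_
      (sym (trans (cong ν₂ m≡dm′) (ν₂[dk]≡ν₂[d] 1≤m′ (even-n′⇒odd-m′ q)))) (sym (cong ν₂ n≡dn′))
      (ν₂[d]<ν₂[dk] 1≤n′ q)

    ν₂[m]≤ν₂[n]⇒odd-m′ : ν₂ m ≤ ν₂ n → ¬ (2 ∣ m′)
    ν₂[m]≤ν₂[n]⇒odd-m′ le p = ℕP.<⇒≱ (even-m′⇒ν₂[n]<ν₂[m] p) le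

    ν₂[n]<ν₂[m]⇒even-m′ : ν₂ n < ν₂ m → 2 ∣ m′
    ν₂[n]<ν₂[m]⇒even-m′ gt with 2 ∣? m′ | 2 ∣? n′
    ... | yes p | _     = p
    ... | no p  | no q  = contradiction (odd-m′∧odd-n′⇒ν₂[m]≡ν₂[n] p q) (λ e → ℕP.<-irrefl (sym e) gt)
    ... | no p  | yes q = contradiction (even-n′⇒ν₂[m]<ν₂[n] q) (ℕP.<-asym gt)

    ν₂[m]≡ν₂[n]⇒odd-m′ : ν₂ m ≡ ν₂ n → ¬ (2 ∣ m′)
    ν₂[m]≡ν₂[n]⇒odd-m′ e p = ℕP.<-irrefl (sym e) (even-m′⇒ν₂[n]<ν₂[m] p)

    ν₂[m]≡ν₂[n]⇒odd-n′ : ν₂ m ≡ ν₂ n → ¬ (2 ∣ n′)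
    ν₂[m]≡ν₂[n]⇒odd-n′ e q = ℕP.<-irrefl e (even-n′⇒ν₂[m]<ν₂[n] q)

-- The ring solver only abstracts over ∀-bound variables, so the local identities below
-- re-quantify a and b instead of using the module parameters.
module LucasIdentities (a b : ℤ) where
  open import Data.Integer using (_+_; _*_; _-_; -_; _^_)
  open import Data.Integer.Tactic.RingSolver using (solve-∀)
  open ≡-Reasoning

  U-addition : ∀ k n →
    U a b (k ℕ.+ n) ≡ U a b (suc k) * U a b n + U a b k * U a b (suc n) - a * U a b k * U a b n
  U-addition zero n = base a (U a b n) (U a b (suc n))
    where
    base : ∀ a x₀ x₁ → x₀ ≡ + 1 * x₀ + + 0 * x₁ - a * + 0 * x₀
    base = solve-∀
  U-addition (suc zero) n = base a b (U a b n) (U a b (suc n))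
    where
    base : ∀ a b x₀ x₁ → x₁ ≡ (a * + 1 + b * + 0) * x₀ + + 1 * x₁ - a * + 1 * x₀
    base = solve-∀
  U-addition (suc (suc k)) n =
    trans (cong₂ (λ p q → a * p + b * q) (U-addition (suc k) n) (U-addition k n))
          (step a b (U a b k) (U a b (suc k)) (U a b n) (U a b (suc n)))
    where
    step : ∀ a b x₀ x₁ y₀ y₁ →
      a * ((a * x₁ + b * x₀) * y₀ + x₁ * y₁ - a * x₁ * y₀) + b * (x₁ * y₀ + x₀ * y₁ - a * x₀ * y₀)
      ≡ (a * (a * x₁ + b * x₀) + b * x₁) * y₀ + (a * x₁ + b * x₀) * y₁ - a * (a * x₁ + b * x₀) * y₀
    step = solve-∀

  V-from-U : ∀ n → V a b n ≡ + 2 * U a b (suc n) - a * U a b n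
  V-from-U zero = base a
    where
    base : ∀ a → + 2 ≡ + 2 * + 1 - a * + 0
    base = solve-∀
  V-from-U (suc zero) = base a b
    where
    base : ∀ a b → a ≡ + 2 * (a * + 1 + b * + 0) - a * + 1
    base = solve-∀
  V-from-U (suc (suc n)) =
    trans (cong₂ (λ p q → a * p + b * q) (V-from-U (suc n)) (V-from-U n))
          (step a b (U a b n) (U a b (suc n)))
    where
    step : ∀ a b x₀ x₁ →
      a * (+ 2 * (a * x₁ + b * x₀) - a * x₁) + b * (+ 2 * x₁ - a * x₀)
      ≡ + 2 * (a * (a * x₁ + b * x₀) + b * x₁) - a * (a * x₁ + b * x₀)
    step = solve-∀

  V+aU≡2U[1+n] : ∀ n → V a b n + a * U a b n ≡ U a b (suc n) * + 2
  V+aU≡2U[1+n] n = trans (cong (_+ a * U a b n) (V-from-U n)) (rearrange (U a b (suc n)) (a * U a b n))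
    where
    rearrange : ∀ s t → (+ 2 * s - t) + t ≡ s * + 2
    rearrange = solve-∀

  U-double : ∀ n → U a b (n ℕ.+ n) ≡ U a b n * V a b n
  U-double n = begin
    U a b (n ℕ.+ n)                                          ≡⟨ U-addition n n ⟩
    U a b (suc n) * U a b n + U a b n * U a b (suc n) - a * U a b n * U a b n
                                                             ≡⟨ factor a (U a b n) (U a b (suc n)) ⟩
    U a b n * (+ 2 * U a b (suc n) - a * U a b n)           ≡⟨ cong (U a b n *_) (sym (V-from-U n)) ⟩
    U a b n * V a b n                                        ∎
    where
    factor : ∀ a x₀ x₁ → x₁ * x₀ + x₀ * x₁ - a * x₀ * x₀ ≡ x₀ * (+ 2 * x₁ - a * x₀)
    factor = solve-∀

  U-Cassini : ∀ h →
    U a b (suc h) * U a b (suc h) - a * U a b (suc h) * U a b h - b * U a b h * U a b h ≡ (- b) ^ h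
  U-Cassini zero = base a b
    where
    base : ∀ a b → + 1 * + 1 - a * + 1 * + 0 - b * + 0 * + 0 ≡ + 1
    base = solve-∀
  U-Cassini (suc h) = trans (step a b (U a b h) (U a b (suc h))) (cong (- b *_) (U-Cassini h))
    where
    step : ∀ a b x₀ x₁ →
      (a * x₁ + b * x₀) * (a * x₁ + b * x₀) - a * (a * x₁ + b * x₀) * x₁ - b * x₁ * x₁
      ≡ - b * (x₁ * x₁ - a * x₁ * x₀ - b * x₀ * x₀)
    step = solve-∀

  V-add-double : ∀ k h → V a b (k ℕ.+ (h ℕ.+ h)) + (- b) ^ h * V a b k ≡ V a b h * V a b (k ℕ.+ h)
  V-add-double k h = begin
      v (k ℕ.+ (h ℕ.+ h)) + (- b) ^ h * v k
    ≡⟨ cong (λ c → v (k ℕ.+ (h ℕ.+ h)) + c * v k) (sym (U-Cassini h)) ⟩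
      v (k ℕ.+ (h ℕ.+ h)) + c * v k
    ≡⟨ cong₂ (λ p q → p + c * q) (V-from-U (k ℕ.+ (h ℕ.+ h))) (V-from-U k) ⟩
      (+ 2 * u (suc (k ℕ.+ (h ℕ.+ h))) - a * u (k ℕ.+ (h ℕ.+ h))) + c * (+ 2 * u (suc k) - a * u k)
    ≡⟨ cong₂ (λ p q → (+ 2 * p - a * q) + c * (+ 2 * u (suc k) - a * u k))
             (U-addition (suc k) (h ℕ.+ h)) (U-addition k (h ℕ.+ h)) ⟩
      (+ 2 * (u (2+ k) * u (h ℕ.+ h) + u (suc k) * u (suc (h ℕ.+ h)) - a * u (suc k) * u (h ℕ.+ h))
        - a * (u (suc k) * u (h ℕ.+ h) + u k * u (suc (h ℕ.+ h)) - a * u k * u (h ℕ.+ h)))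
        + c * (+ 2 * u (suc k) - a * u k)
    ≡⟨ cong₂ (λ p q → (+ 2 * (u (2+ k) * p + u (suc k) * q - a * u (suc k) * p)
                        - a * (u (suc k) * p + u k * q - a * u k * p)) + c * (+ 2 * u (suc k) - a * u k))
             (U-addition h h) (U-addition (suc h) h) ⟩
      _
    ≡⟨ expand a b (u k) (u (suc k)) (u h) (u (suc h)) ⟩
      (+ 2 * u (suc h) - a * u h)
        * (+ 2 * (u (2+ k) * u h + u (suc k) * u (suc h) - a * u (suc k) * u h)
            - a * (u (suc k) * u h + u k * u (suc h) - a * u k * u h))
    ≡⟨ sym (cong₂ _*_ (V-from-U h) (cong₂ (λ p q → + 2 * p - a * q) (U-addition (suc k) h) (U-addition k h))) ⟩
      v h * (+ 2 * u (suc (k ℕ.+ h)) - a * u (k ℕ.+ h))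
    ≡⟨ sym (cong (v h *_) (V-from-U (k ℕ.+ h))) ⟩
      v h * v (k ℕ.+ h)
    ∎
    where
    u v : ℕ → ℤ
    u = U a b
    v = V a b
    2+_ : ℕ → ℕ
    2+ n = suc (suc n)
    c : ℤ
    c = u (suc h) * u (suc h) - a * u (suc h) * u h - b * u h * u h
    expand : ∀ a b x₀ x₁ y₀ y₁ →
      (+ 2 * ((a * x₁ + b * x₀) * (y₁ * y₀ + y₀ * y₁ - a * y₀ * y₀)
               + x₁ * ((a * y₁ + b * y₀) * y₀ + y₁ * y₁ - a * y₁ * y₀) - a * x₁ * (y₁ * y₀ + y₀ * y₁ - a * y₀ * y₀))
        - a * (x₁ * (y₁ * y₀ + y₀ * y₁ - a * y₀ * y₀)
               + x₀ * ((a * y₁ + b * y₀) * y₀ + y₁ * y₁ - a * y₁ * y₀) - a * x₀ * (y₁ * y₀ + y₀ * y₁ - a * y₀ * y₀)))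
      + (y₁ * y₁ - a * y₁ * y₀ - b * y₀ * y₀) * (+ 2 * x₁ - a * x₀)
      ≡ (+ 2 * y₁ - a * y₀) * (+ 2 * ((a * x₁ + b * x₀) * y₀ + x₁ * y₁ - a * x₁ * y₀) - a * (x₁ * y₀ + x₀ * y₁ - a * x₀ * y₀))
    expand = solve-∀

  U-multiple-expansion : ∀ t j → Σ ℤ λ A → Σ ℤ λ B →
      (U a b (suc j ℕ.* t) ≡ U a b t * (+ (suc j) * (U a b (suc t) ^ j) + U a b t * A))
    × (U a b (suc (suc j ℕ.* t)) ≡ U a b (suc t) ^ suc j + U a b t * B)
  U-multiple-expansion t zero =
      + 0 , + 0
    , trans (cong (U a b) (ℕP.+-identityʳ t)) (base₁ (U a b t))
    , trans (cong (λ z → U a b (suc z)) (ℕP.+-identityʳ t)) (base₂ (U a b t) (U a b (suc t)))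
    where
    base₁ : ∀ x → x ≡ x * (+ 1 * + 1 + x * + 0)
    base₁ = solve-∀
    base₂ : ∀ x y → y ≡ y * + 1 + x * + 0
    base₂ = solve-∀
  U-multiple-expansion t (suc j) with U-multiple-expansion t j
  ... | A , B , eq₁ , eq₂ = A′ , B′ , eq₁′ , eq₂′
    where
    n = suc j ℕ.* t
    x = U a b t
    y = U a b (suc t)
    q = y ^ j
    k = + (suc j)
    A′ = B + A * (y - a * x) - a * k * q
    B′ = B * y + b * x * (k * q + x * A)
    open ≡-Reasoning
    eq₁′ : U a b (t ℕ.+ n) ≡ x * (+ (suc (suc j)) * (y * q) + x * A′)
    eq₁′ = begin
      U a b (t ℕ.+ n)                                  ≡⟨ cong (U a b) (ℕP.+-comm t n) ⟩
      U a b (n ℕ.+ t)                                  ≡⟨ U-addition n t ⟩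
      U a b (suc n) * x + U a b n * y - a * U a b n * x ≡⟨ cong₂ (λ p r → p * x + r * y - a * r * x) eq₂ eq₁ ⟩
      (y * q + x * B) * x + (x * (k * q + x * A)) * y - a * (x * (k * q + x * A)) * x
                                                        ≡⟨ step₁ a x y q A B k ⟩
      x * ((+ 1 + k) * (y * q) + x * A′)               ∎
      where
      step₁ : ∀ a x y q A B k → (y * q + x * B) * x + (x * (k * q + x * A)) * y - a * (x * (k * q + x * A)) * x
        ≡ x * ((+ 1 + k) * (y * q) + x * (B + A * (y - a * x) - a * k * q))
      step₁ = solve-∀
    eq₂′ : U a b (suc (t ℕ.+ n)) ≡ y * (y * q) + x * B′
    eq₂′ = begin
      U a b (suc (t ℕ.+ n))                            ≡⟨ cong (λ z → U a b (suc z)) (ℕP.+-comm t n) ⟩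
      U a b (suc n ℕ.+ t)                              ≡⟨ U-addition (suc n) t ⟩
      U a b (suc (suc n)) * x + U a b (suc n) * y - a * U a b (suc n) * x
                                                        ≡⟨ cong₂ (λ p r → (a * p + b * r) * x + p * y - a * p * x) eq₂ eq₁ ⟩
      (a * (y * q + x * B) + b * (x * (k * q + x * A))) * x + (y * q + x * B) * y - a * (y * q + x * B) * x
                                                        ≡⟨ step₂ a b x y q A B k ⟩
      y * (y * q) + x * B′                             ∎
      where
      step₂ : ∀ a b x y q A B k →
        (a * (y * q + x * B) + b * (x * (k * q + x * A))) * x + (y * q + x * B) * y - a * (y * q + x * B) * x
        ≡ y * (y * q) + x * (B * y + b * x * (k * q + x * A))
      step₂ = solve-∀

module LucasDivisibility (a b : ℤ) (a⊥b : ℤC.Coprime a b) where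
  open import Data.Integer using (_+_; _*_; _-_; -_; _^_; ≢-nonZero)
  open import Data.Integer.Divisibility.Signed
  open import Data.Integer.Tactic.RingSolver using (solve-∀)
  open SignedCoprimality
  open LucasIdentities a b

  U[1+n]-coprime-b : ∀ n → Coprimeˢ (U a b (suc n)) b
  U[1+n]-coprime-b zero    p q = p
  U[1+n]-coprime-b (suc n) {d} p q =
    U[1+n]-coprime-b n (coprimeˢ-divisor d-coprime-a (∣m+n∣n⇒∣m p (∣m⇒∣m*n (U a b n) q))) q
    where
    d-coprime-a : Coprimeˢ d a
    d-coprime-a e₁ e₂ = coprime⇒coprimeˢ a⊥b e₂ (∣-trans e₁ q)

  U[n]-coprime-U[1+n] : ∀ n → Coprimeˢ (U a b n) (U a b (suc n))
  U[n]-coprime-U[1+n] zero    p q = q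
  U[n]-coprime-U[1+n] (suc n) p q =
    U[n]-coprime-U[1+n] n (coprimeˢ-divisor (coprimeˢ-∣ˡ p (U[1+n]-coprime-b n)) (∣m+n∣m⇒∣n q (∣n⇒∣m*n a p))) p

  ∣U[n]∣V[n]⇒∣2 : ∀ n {d} → d ∣ U a b n → d ∣ V a b n → d ∣ + 2
  ∣U[n]∣V[n]⇒∣2 n {d} p q =
    coprimeˢ-divisor (coprimeˢ-∣ˡ p (U[n]-coprime-U[1+n] n)) (subst (d ∣_) (V+aU≡2U[1+n] n) (∣m∣n⇒∣m+n q (∣n⇒∣m*n a p)))

  ∣U[i]∣U[n]⇒∣U[i+n] : ∀ {d} i n → d ∣ U a b i → d ∣ U a b n → d ∣ U a b (i ℕ.+ n)
  ∣U[i]∣U[n]⇒∣U[i+n] {d} i n p q = subst (d ∣_) (sym (U-addition i n))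
    (∣m∣n⇒∣m-n (∣m∣n⇒∣m+n (∣n⇒∣m*n (U a b (suc i)) q) (∣m⇒∣m*n (U a b (suc n)) p)) (∣n⇒∣m*n (a * U a b i) q))

  ∣U[i+n]∣U[n]⇒∣U[i] : ∀ {d} i n → d ∣ U a b (i ℕ.+ n) → d ∣ U a b n → d ∣ U a b i
  ∣U[i+n]∣U[n]⇒∣U[i] {d} i n p q =
    coprimeˢ-divisor d-coprime-W (∣m+n∣m⇒∣n (subst (d ∣_) U[i+n]≡ p) (∣n⇒∣m*n (U a b (suc i)) q))
    where
    W = U a b (suc n) - a * U a b n
    regroup : ∀ a x₁ y₀ x₀ y₁ → x₁ * y₀ + x₀ * y₁ - a * x₀ * y₀ ≡ x₁ * y₀ + (y₁ - a * y₀) * x₀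
    regroup = solve-∀
    U[i+n]≡ : U a b (i ℕ.+ n) ≡ U a b (suc i) * U a b n + W * U a b i
    U[i+n]≡ = trans (U-addition i n) (regroup a (U a b (suc i)) (U a b n) (U a b i) (U a b (suc n)))
    cancel : ∀ s t → (s - t) + t ≡ s
    cancel = solve-∀
    d-coprime-W : Coprimeˢ d W
    d-coprime-W e₁ e₂ = U[n]-coprime-U[1+n] n (∣-trans e₁ q)
      (subst (_ ∣_) (cancel (U a b (suc n)) (a * U a b n)) (∣m∣n⇒∣m+n e₂ (∣n⇒∣m*n a (∣-trans e₁ q))))

  V[h]∣V[h+q*2h] : ∀ h q → V a b h ∣ V a b (h ℕ.+ q ℕ.* (h ℕ.+ h))
  V[h]∣V[h+q*2h] h zero    = subst (λ z → V a b h ∣ V a b z) (sym (ℕP.+-identityʳ h)) ∣-refl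
  V[h]∣V[h+q*2h] h (suc q) = subst (λ z → V a b h ∣ V a b z) index
    (∣m+n∣n⇒∣m (subst (V a b h ∣_) (sym (V-add-double k h)) (∣m⇒∣m*n (V a b (k ℕ.+ h)) ∣-refl))
               (∣n⇒∣m*n ((- b) ^ h) (V[h]∣V[h+q*2h] h q)))
    where
    k = h ℕ.+ q ℕ.* (h ℕ.+ h)
    index : k ℕ.+ (h ℕ.+ h) ≡ h ℕ.+ suc q ℕ.* (h ℕ.+ h)
    index = trans (ℕP.+-assoc h _ _) (cong (h ℕ.+_) (ℕP.+-comm (q ℕ.* (h ℕ.+ h)) (h ℕ.+ h)))

  M*U[t]∣U[kt]⇔M∣k : ∀ t j {M} → M ∣ U a b t → U a b t ≢ + 0 →
    (M * U a b t ∣ U a b (suc j ℕ.* t)) ⇔ (M ∣ + (suc j))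
  M*U[t]∣U[kt]⇔M∣k t j {M} M∣U[t] U[t]≢0 with U-multiple-expansion t j
  ... | A , B , expansion , _ = mk⇔ to from
    where
    instance
      _ = ≢-nonZero U[t]≢0
    Q = U a b (suc t) ^ j
    M-coprime-Q : Coprimeˢ M Q
    M-coprime-Q = coprimeˢ-^ʳ j (coprimeˢ-∣ˡ M∣U[t] (U[n]-coprime-U[1+n] t))
    to : M * U a b t ∣ U a b (suc j ℕ.* t) → M ∣ + suc j
    to h = coprimeˢ-divisor M-coprime-Q (subst (M ∣_) (ℤP.*-comm (+ suc j) Q)
      (∣m+n∣n⇒∣m (*-cancelˡ-∣ (U a b t) (subst₂ _∣_ (ℤP.*-comm M (U a b t)) expansion h)) (∣m⇒∣m*n A M∣U[t])))
    from : M ∣ + suc j → M * U a b t ∣ U a b (suc j ℕ.* t)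
    from h = subst₂ _∣_ (ℤP.*-comm (U a b t) M) (sym expansion)
      (*-monoʳ-∣ (U a b t) (∣m∣n⇒∣m+n (∣m⇒∣m*n Q h) (∣m⇒∣m*n A M∣U[t])))

module LucasGrowth where
  open import Data.Nat using (_+_; _*_; _∸_; _≤_; _<_)
  open import Data.Nat.Tactic.RingSolver using (solve-∀)

  record Growth (z : ℕ → ℤ) : Set where
    field
      nonneg        : ∀ k → z (suc k) ≡ + ∣ z (suc k) ∣
      positive      : ∀ k → 1 ≤ ∣ z (suc k) ∣
      nondecreasing : ∀ k → ∣ z (suc k) ∣ ≤ ∣ z (suc (suc k)) ∣
      increasing    : ∀ k → ∣ z (suc (suc k)) ∣ < ∣ z (suc (suc (suc k))) ∣
      doubling      : ∀ k → ∣ z (suc k) ∣ < ∣ z (suc (suc k)) ∣ →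
                      2 * ∣ z (suc k) ∣ < ∣ z (suc (suc (suc k))) ∣

  record GrowthInvariant (z : ℕ → ℤ) : Set₁ where
    field
      Related       : ℕ → ℕ → Set
      next          : ℕ → ℕ → ℕ
      next-correct  : ∀ {k x y} → z (suc k) ≡ + x → z (suc (suc k)) ≡ + y → Related x y →
                      z (suc (suc (suc k))) ≡ + next x y
      x₀ y₀         : ℕ
      z₁≡x₀         : z 1 ≡ + x₀
      z₂≡y₀         : z 2 ≡ + y₀
      related₀      : Related x₀ y₀
      related-next  : ∀ {x y} → Related x y → Related y (next x y)
      positive      : ∀ {x y} → Related x y → 1 ≤ x
      nondecreasing : ∀ {x y} → Related x y → x ≤ y
      increasing    : ∀ {x y} → Related x y → y < next x y
      doubling      : ∀ {x y} → Related x y → x < y → 2 * x < next x y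

  invariant⇒growth : ∀ {z} → GrowthInvariant z → Growth z
  invariant⇒growth {z} I = record
    { nonneg        = λ k → proj₁ (state k)
    ; positive      = λ k → positive (related k)
    ; nondecreasing = λ k → nondecreasing (related k)
    ; increasing    = λ k → subst (_ <_) (sym (∣z₃∣≡next k)) (increasing (related k))
    ; doubling      = λ k x<y → subst (_ <_) (sym (∣z₃∣≡next k)) (doubling (related k) x<y)
    }
    where
    open GrowthInvariant I
    abs-+ : ∀ {w x} → w ≡ + x → ∣ w ∣ ≡ x
    abs-+ refl = refl
    nonneg-at : ∀ {w x} → w ≡ + x → w ≡ + ∣ w ∣
    nonneg-at refl = refl
    State : ℕ → Set
    State k = z (suc k) ≡ + ∣ z (suc k) ∣ × z (suc (suc k)) ≡ + ∣ z (suc (suc k)) ∣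
            × Related ∣ z (suc k) ∣ ∣ z (suc (suc k)) ∣
    state : ∀ k → State k
    state zero = nonneg-at z₁≡x₀ , nonneg-at z₂≡y₀ , subst₂ Related (sym (abs-+ z₁≡x₀)) (sym (abs-+ z₂≡y₀)) related₀
    state (suc k) with state k
    ... | e₁ , e₂ , r = e₂ , nonneg-at e₃ , subst (Related _) (sym (abs-+ e₃)) (related-next r)
      where
      e₃ = next-correct e₁ e₂ r
    related : ∀ k → Related ∣ z (suc k) ∣ ∣ z (suc (suc k)) ∣
    related k = proj₂ (proj₂ (state k))
    ∣z₃∣≡next : ∀ k → ∣ z (suc (suc (suc k))) ∣ ≡ next ∣ z (suc k) ∣ ∣ z (suc (suc k)) ∣
    ∣z₃∣≡next k = abs-+ (next-correct (proj₁ (state k)) (proj₁ (proj₂ (state k))) (related k))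

  positive-invariant : ∀ A B (z : ℕ → ℤ) →
    (∀ k → z (suc (suc k)) ≡ + suc A ℤ.* z (suc k) ℤ.+ + suc B ℤ.* z k) →
    ∀ {x₀ y₀} → z 1 ≡ + x₀ → z 2 ≡ + y₀ → 1 ≤ x₀ → x₀ ≤ y₀ → GrowthInvariant z
  positive-invariant A B z rec {x₀} {y₀} z₁≡ z₂≡ 1≤x₀ x₀≤y₀ = record
    { Related = λ x y → 1 ≤ x × x ≤ y
    ; next = next
    ; next-correct = λ {k} {x} {y} e₁ e₂ _ → next-correct k e₁ e₂
    ; x₀ = x₀ ; y₀ = y₀ ; z₁≡x₀ = z₁≡ ; z₂≡y₀ = z₂≡ ; related₀ = 1≤x₀ , x₀≤y₀
    ; related-next = λ (1≤x , x≤y) → ℕP.≤-trans 1≤x x≤y , ℕP.<⇒≤ (increasing 1≤x)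
    ; positive = proj₁
    ; nondecreasing = proj₂
    ; increasing = λ r → increasing (proj₁ r)
    ; doubling = λ r → doubling (proj₁ r)
    }
    where
    next : ℕ → ℕ → ℕ
    next x y = suc A * y + suc B * x
    next-correct : ∀ k {x y} → z (suc k) ≡ + x → z (suc (suc k)) ≡ + y → z (suc (suc (suc k))) ≡ + next x y
    next-correct k {x} {y} e₁ e₂ = trans (rec (suc k))
      (trans (cong₂ (λ p q → + suc A ℤ.* p ℤ.+ + suc B ℤ.* q) e₂ e₁)
             (cong₂ ℤ._+_ (sym (ℤP.pos-* (suc A) y)) (sym (ℤP.pos-* (suc B) x))))
    increasing : ∀ {x y} → 1 ≤ x → y < next x y
    increasing {x} {y} 1≤x = subst (_< next x y) (ℕP.+-identityʳ y)
      (ℕP.+-mono-≤-< (ℕP.m≤n*m y (suc A)) (ℕP.*-mono-≤ (s≤s (z≤n {B})) 1≤x))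
    doubling : ∀ {x y} → 1 ≤ x → x < y → 2 * x < next x y
    doubling {x} {y} _ x<y = ℕP.<-≤-trans
      (subst (_< y + x) (sym (cong (λ w → x + w) (ℕP.+-identityʳ x))) (ℕP.+-monoˡ-< x x<y))
      (ℕP.+-mono-≤ (ℕP.m≤n*m y (suc A)) (ℕP.m≤n*m x (suc B)))

  -- b = - C < 0: Δ > 0 means A² > 4C, and this keeps the ratio of consecutive terms ≥ A/2 ≥ 3/2.
  module _ (A C : ℕ) (1≤C : 1 ≤ C) (4C<A² : 4 * C < A * A) where

    3≤A : 3 ≤ A
    3≤A with 3 ℕ.≤? A
    ... | yes 3≤A = 3≤A
    ... | no 3≰A = contradiction 4C<A² (ℕP.≤⇒≯ (ℕP.≤-trans (ℕP.*-mono-≤ A≤2 A≤2) (ℕP.*-monoʳ-≤ 4 1≤C)))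
      where
      A≤2 : A ≤ 2
      A≤2 = ℕP.≤-pred (ℕP.≰⇒> 3≰A)

    private
      instance
        _ = ℕ.>-nonZero (ℕP.≤-trans (s≤s z≤n) 3≤A)

      next : ℕ → ℕ → ℕ
      next x y = A * y ∸ C * x

      2Cx≤Ay : ∀ {x y} → A * x ≤ 2 * y → 2 * (C * x) ≤ A * y
      2Cx≤Ay {x} {y} Ax≤2y = ℕP.*-cancelˡ-≤ A (begin
        A * (2 * (C * x))  ≡⟨ solve₁ A C x ⟩
        2 * C * (A * x)    ≤⟨ ℕP.*-monoʳ-≤ (2 * C) Ax≤2y ⟩
        2 * C * (2 * y)    ≡⟨ solve₂ C y ⟩
        4 * C * y          ≤⟨ ℕP.*-monoˡ-≤ y (ℕP.<⇒≤ 4C<A²) ⟩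
        A * A * y          ≡⟨ ℕP.*-assoc A A y ⟩
        A * (A * y)        ∎)
        where
        open ℕP.≤-Reasoning
        solve₁ : ∀ A C x → A * (2 * (C * x)) ≡ 2 * C * (A * x)
        solve₁ = solve-∀
        solve₂ : ∀ C y → 2 * C * (2 * y) ≡ 4 * C * y
        solve₂ = solve-∀

      Cx≤Ay : ∀ {x y} → A * x ≤ 2 * y → C * x ≤ A * y
      Cx≤Ay {x} {y} r = ℕP.≤-trans (ℕP.m≤m+n (C * x) _)
        (subst (_≤ A * y) (cong (λ w → C * x + w) (sym (ℕP.+-identityʳ _))) (2Cx≤Ay r))

      y-positive : ∀ {x y} → 1 ≤ x → A * x ≤ 2 * y → 1 ≤ y
      y-positive {x} {zero}  1≤x r = contradiction (ℕP.≤-trans (ℕP.*-mono-≤ 3≤A 1≤x) r) λ ()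
      y-positive {x} {suc y} _   _ = s≤s z≤n

      Ay≤2next : ∀ {x y} → A * x ≤ 2 * y → A * y ≤ 2 * next x y
      Ay≤2next {x} {y} r = ℕP.+-cancelʳ-≤ (2 * (C * x)) _ _ (begin
        A * y + 2 * (C * x)            ≤⟨ ℕP.+-monoʳ-≤ (A * y) (2Cx≤Ay r) ⟩
        A * y + A * y                  ≡⟨ cong (λ w → A * y + w) (sym (ℕP.+-identityʳ _)) ⟩
        2 * (A * y)                    ≡⟨ cong (2 *_) (sym (ℕP.m∸n+n≡m (Cx≤Ay r))) ⟩
        2 * (next x y + C * x)         ≡⟨ ℕP.*-distribˡ-+ 2 (next x y) (C * x) ⟩
        2 * next x y + 2 * (C * x)     ∎)
        where open ℕP.≤-Reasoning

      y<next : ∀ {x y} → 1 ≤ x → A * x ≤ 2 * y → y < next x y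
      y<next {x} {y} 1≤x r = ℕP.*-cancelˡ-< 2 _ _ (begin-strict
        2 * y          <⟨ ℕP.m<m+n (2 * y) (y-positive 1≤x r) ⟩
        2 * y + y      ≡⟨ solve₃ y ⟩
        3 * y          ≤⟨ ℕP.*-monoˡ-≤ y 3≤A ⟩
        A * y          ≤⟨ Ay≤2next r ⟩
        2 * next x y   ∎)
        where
        open ℕP.≤-Reasoning
        solve₃ : ∀ y → 2 * y + y ≡ 3 * y
        solve₃ = solve-∀

      2x<next : ∀ {x y} → 1 ≤ x → A * x ≤ 2 * y → 2 * x < next x y
      2x<next {x} {y} 1≤x r = ℕP.*-cancelˡ-< 4 _ _ (begin-strict
        4 * (2 * x)         <⟨ ℕP.m<m+n (4 * (2 * x)) 1≤x ⟩
        4 * (2 * x) + x     ≡⟨ solve₄ x ⟩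
        3 * (3 * x)         ≤⟨ ℕP.*-mono-≤ 3≤A (ℕP.*-monoˡ-≤ x 3≤A) ⟩
        A * (A * x)         ≤⟨ ℕP.*-monoʳ-≤ A r ⟩
        A * (2 * y)         ≡⟨ solve₅ A y ⟩
        2 * (A * y)         ≤⟨ ℕP.*-monoʳ-≤ 2 (Ay≤2next r) ⟩
        2 * (2 * next x y)  ≡⟨ sym (ℕP.*-assoc 2 2 (next x y)) ⟩
        4 * next x y        ∎)
        where
        open ℕP.≤-Reasoning
        solve₄ : ∀ x → 4 * (2 * x) + x ≡ 3 * (3 * x)
        solve₄ = solve-∀
        solve₅ : ∀ A y → A * (2 * y) ≡ 2 * (A * y)
        solve₅ = solve-∀

      x≤y : ∀ {x y} → A * x ≤ 2 * y → x ≤ y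
      x≤y {x} {y} r = ℕP.*-cancelˡ-≤ 2 (ℕP.≤-trans (ℕP.*-monoˡ-≤ x (ℕP.≤-trans (s≤s (s≤s z≤n)) 3≤A)) r)

    negative-invariant : (z : ℕ → ℤ) →
      (∀ k → z (suc (suc k)) ≡ + A ℤ.* z (suc k) ℤ.+ ℤ.- (+ C) ℤ.* z k) →
      ∀ {x₀ y₀} → z 1 ≡ + x₀ → z 2 ≡ + y₀ → 1 ≤ x₀ → A * x₀ ≤ 2 * y₀ → GrowthInvariant z
    negative-invariant z rec {x₀} {y₀} z₁≡ z₂≡ 1≤x₀ r₀ = record
      { Related = λ x y → 1 ≤ x × A * x ≤ 2 * y
      ; next = next
      ; next-correct = λ {k} e₁ e₂ r → next-correct k e₁ e₂ (proj₂ r)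
      ; x₀ = x₀ ; y₀ = y₀ ; z₁≡x₀ = z₁≡ ; z₂≡y₀ = z₂≡ ; related₀ = 1≤x₀ , r₀
      ; related-next = λ (1≤x , r) → y-positive 1≤x r , Ay≤2next r
      ; positive = proj₁
      ; nondecreasing = λ r → x≤y (proj₂ r)
      ; increasing = λ (1≤x , r) → y<next 1≤x r
      ; doubling = λ (1≤x , r) _ → 2x<next 1≤x r
      }
      where
      next-correct : ∀ k {x y} → z (suc k) ≡ + x → z (suc (suc k)) ≡ + y → A * x ≤ 2 * y →
                     z (suc (suc (suc k))) ≡ + next x y
      next-correct k {x} {y} e₁ e₂ r = begin
        z (suc (suc (suc k)))              ≡⟨ rec (suc k) ⟩
        + A ℤ.* z (suc (suc k)) ℤ.+ ℤ.- (+ C) ℤ.* z (suc k)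
                                           ≡⟨ cong₂ (λ p q → + A ℤ.* p ℤ.+ ℤ.- (+ C) ℤ.* q) e₂ e₁ ⟩
        + A ℤ.* + y ℤ.+ ℤ.- (+ C) ℤ.* + x  ≡⟨ cong₂ ℤ._+_ (sym (ℤP.pos-* A y))
                                                (trans (sym (ℤP.neg-distribˡ-* (+ C) (+ x))) (cong ℤ.-_ (sym (ℤP.pos-* C x)))) ⟩
        + (A * y) ℤ.- + (C * x)            ≡⟨ ℤP.m-n≡m⊖n (A * y) (C * x) ⟩
        (A * y) ℤ.⊖ (C * x)                ≡⟨ ℤP.⊖-≥ (Cx≤Ay r) ⟩
        + next x y                         ∎
        where open ≡-Reasoning

  record LucasGrowth (a b : ℤ) : Set where
    field
      U-growth  : Growth (U a b)
      V-growth  : Growth (V a b)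
      ∣V₁∣<∣V₂∣ : ∣ V a b 1 ∣ < ∣ V a b 2 ∣

  U₂≡a : ∀ a b → a ℤ.* + 1 ℤ.+ b ℤ.* + 0 ≡ a
  U₂≡a a b = trans (cong₂ ℤ._+_ (ℤP.*-identityʳ a) (ℤP.*-zeroʳ b)) (ℤP.+-identityʳ a)

  private
    0<m-n⇒n<m : ∀ m n → + 0 ℤ.< + m ℤ.+ ℤ.- (+ n) → n < m
    0<m-n⇒n<m m n 0<m-n with n ℕ.<? m
    ... | yes n<m = n<m
    ... | no n≮m = contradiction 0<m-n (ℤP.≤⇒≯ (subst (ℤ._≤ + 0)
            (sym (trans (ℤP.m-n≡m⊖n m n) (ℤP.⊖-≤ (ℕP.≮⇒≥ n≮m)))) ℤP.neg-≤-pos))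

  lucas-growth : ∀ A b → b ≢ + 0 → Δ (+ suc A) b ℤ.> + 0 → LucasGrowth (+ suc A) b
  lucas-growth A (+ zero)  b≢0 _ = contradiction refl b≢0
  lucas-growth A (+ suc B) _   _ = record
    { U-growth  = invariant⇒growth (positive-invariant A B (U a b) (λ _ → refl) refl (U₂≡a a b) (s≤s z≤n) (s≤s z≤n))
    ; V-growth  = invariant⇒growth (positive-invariant A B (V a b) (λ _ → refl) refl V₂≡ (s≤s z≤n) (ℕP.<⇒≤ V₁<V₂))
    ; ∣V₁∣<∣V₂∣ = V₁<V₂
    }
    where
    a = + suc A
    b = + suc B
    V₂≡ : V a b 2 ≡ + (suc A * suc A + suc B * 2)
    V₂≡ = cong₂ ℤ._+_ (sym (ℤP.pos-* (suc A) (suc A))) (sym (ℤP.pos-* (suc B) 2))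
    V₁<V₂ : suc A < suc A * suc A + suc B * 2
    V₁<V₂ = ℕP.≤-trans (ℕP.n≤1+n (suc (suc A)))
      (subst (_≤ suc A * suc A + suc B * 2) (ℕP.+-comm (suc A) 2)
             (ℕP.+-mono-≤ (ℕP.m≤m*n (suc A) (suc A)) (ℕP.m≤n*m 2 (suc B))))
  lucas-growth A -[1+ C ] _ Δ>0 = record
    { U-growth  = invariant⇒growth (negative-invariant (suc A) (suc C) (s≤s z≤n) 4C<A²
                    (U a b) (λ _ → refl) refl (U₂≡a a b) (s≤s z≤n) A*1≤2A)
    ; V-growth  = invariant⇒growth (negative-invariant (suc A) (suc C) (s≤s z≤n) 4C<A²
                    (V a b) (λ _ → refl) refl V₂≡ (s≤s z≤n) A²≤2w)
    ; ∣V₁∣<∣V₂∣ = subst (suc A <_) (cong ∣_∣ (sym V₂≡)) A<w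
    }
    where
    a = + suc A
    b = -[1+ C ]
    A² = suc A * suc A
    Δ≡ : Δ a b ≡ + A² ℤ.+ ℤ.- (+ (4 * suc C))
    Δ≡ = cong₂ ℤ._+_ (sym (ℤP.pos-* (suc A) (suc A)))
           (trans (sym (ℤP.neg-distribʳ-* (+ 4) (+ suc C))) (cong ℤ.-_ (sym (ℤP.pos-* 4 (suc C)))))
    4C<A² : 4 * suc C < A²
    4C<A² = 0<m-n⇒n<m A² (4 * suc C) (subst (+ 0 ℤ.<_) Δ≡ Δ>0)
    A*1≤2A : suc A * 1 ≤ 2 * suc A
    A*1≤2A = subst (_≤ 2 * suc A) (sym (ℕP.*-identityʳ (suc A))) (ℕP.m≤m+n (suc A) _)
    2C≤A² : suc C * 2 ≤ A²
    2C≤A² = ℕP.≤-trans (ℕP.≤-reflexive (ℕP.*-comm (suc C) 2))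
              (ℕP.≤-trans (ℕP.*-monoˡ-≤ (suc C) {2} {4} (s≤s (s≤s z≤n))) (ℕP.<⇒≤ 4C<A²))
    w = A² ∸ suc C * 2
    V₂≡ : V a b 2 ≡ + w
    V₂≡ = trans (cong₂ ℤ._+_ (sym (ℤP.pos-* (suc A) (suc A)))
                  (trans (sym (ℤP.neg-distribˡ-* (+ suc C) (+ 2))) (cong ℤ.-_ (sym (ℤP.pos-* (suc C) 2)))))
               (trans (ℤP.m-n≡m⊖n A² (suc C * 2)) (ℤP.⊖-≥ 2C≤A²))
    A²≤2w : A² ≤ 2 * w
    A²≤2w = ℕP.+-cancelʳ-≤ (4 * suc C) _ _ (begin
      A² + 4 * suc C           ≤⟨ ℕP.+-monoʳ-≤ A² (ℕP.<⇒≤ 4C<A²) ⟩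
      A² + A²                  ≡⟨ cong (λ x → A² + x) (sym (ℕP.+-identityʳ A²)) ⟩
      2 * A²                   ≡⟨ cong (2 *_) (sym (ℕP.m∸n+n≡m 2C≤A²)) ⟩
      2 * (w + suc C * 2)      ≡⟨ distribute w (suc C) ⟩
      2 * w + 4 * suc C        ∎)
      where
      open ℕP.≤-Reasoning
      distribute : ∀ w C → 2 * (w + C * 2) ≡ 2 * w + 4 * C
      distribute = solve-∀
    A<w : suc A < w
    A<w = ℕP.*-cancelˡ-< 2 _ _ (begin-strict
      2 * suc A                <⟨ ℕP.m<m+n (2 * suc A) (s≤s z≤n) ⟩
      2 * suc A + suc A        ≡⟨ triple (suc A) ⟩
      3 * suc A                ≤⟨ ℕP.*-monoˡ-≤ (suc A) (3≤A (suc A) (suc C) (s≤s z≤n) 4C<A²) ⟩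
      A²                       ≤⟨ A²≤2w ⟩
      2 * w                    ∎)
      where
      open ℕP.≤-Reasoning
      triple : ∀ x → 2 * x + x ≡ 3 * x
      triple = solve-∀

module PositiveLucas (a b : ℤ) (a⊥b : ℤC.Coprime a b) (G : LucasGrowth.LucasGrowth a b) where
  open import Data.Nat using (_+_; _*_; _≤_; _<_)
  open import Data.Nat.DivMod using (_/_)
  open import Data.Nat.Tactic.RingSolver using (solve-∀)
  open import Data.Nat.Divisibility
  open import Data.Nat.GCD using (gcd; gcd-GCD; gcd[m,n]∣m; gcd[m,n]∣n; gcd-greatest; c*gcd[m,n]≡gcd[cm,cn]; module Bézout)
  import Data.Integer.Divisibility.Signed as ℤS
  open LucasIdentities a b
  open LucasDivisibility a b a⊥b
  open LucasGrowth
  open NatDivisibility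
  open LucasGrowth.LucasGrowth G
  open Growth

  u v : ℕ → ℕ
  u k = ∣ U a b k ∣
  v k = ∣ V a b k ∣

  U≡+u : ∀ k → U a b k ≡ + u k
  U≡+u zero    = refl
  U≡+u (suc k) = nonneg U-growth k

  V≡+v : ∀ k → V a b k ≡ + v k
  V≡+v zero    = refl
  V≡+v (suc k) = nonneg V-growth k

  ∣u[i]∣u[n]⇒∣u[i+n] : ∀ {d} i n → d ∣ u i → d ∣ u n → d ∣ u (i + n)
  ∣u[i]∣u[n]⇒∣u[i+n] {d} i n p q =
    ℤS.∣⇒∣ᵤ (∣U[i]∣U[n]⇒∣U[i+n] i n (ℤS.∣ᵤ⇒∣ {+ d} p) (ℤS.∣ᵤ⇒∣ {+ d} q))

  ∣u[i+n]∣u[n]⇒∣u[i] : ∀ {d} i n → d ∣ u (i + n) → d ∣ u n → d ∣ u i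
  ∣u[i+n]∣u[n]⇒∣u[i] {d} i n p q =
    ℤS.∣⇒∣ᵤ (∣U[i+n]∣U[n]⇒∣U[i] i n (ℤS.∣ᵤ⇒∣ {+ d} p) (ℤS.∣ᵤ⇒∣ {+ d} q))

  ∣u[n]⇒∣u[kn] : ∀ {d} k n → d ∣ u n → d ∣ u (k * n)
  ∣u[n]⇒∣u[kn] zero    n p = _ ∣0
  ∣u[n]⇒∣u[kn] (suc k) n p = ∣u[i]∣u[n]⇒∣u[i+n] n (k * n) p (∣u[n]⇒∣u[kn] k n p)

  m∣n⇒u[m]∣u[n] : ∀ {m n} → m ∣ n → u m ∣ u n
  m∣n⇒u[m]∣u[n] {m} (divides k refl) = ∣u[n]⇒∣u[kn] k m ∣-refl

  ∣u[m]∣u[n]⇒∣u[gcd[m,n]] : ∀ {d} m n → d ∣ u m → d ∣ u n → d ∣ u (gcd m n)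
  ∣u[m]∣u[n]⇒∣u[gcd[m,n]] {d} m n p q with Bézout.identity (gcd-GCD m n)
  ... | Bézout.+- x y eq = ∣u[i+n]∣u[n]⇒∣u[i] (gcd m n) (y * n)
          (subst (λ z → d ∣ u z) (sym eq) (∣u[n]⇒∣u[kn] x m p)) (∣u[n]⇒∣u[kn] y n q)
  ... | Bézout.-+ x y eq = ∣u[i+n]∣u[n]⇒∣u[i] (gcd m n) (x * m)
          (subst (λ z → d ∣ u z) (sym eq) (∣u[n]⇒∣u[kn] y n q)) (∣u[n]⇒∣u[kn] x m p)

  u[2n]≡u[n]v[n] : ∀ n → u (2 * n) ≡ u n * v n
  u[2n]≡u[n]v[n] n = trans (cong (λ w → u (n + w)) (ℕP.+-identityʳ n))
    (trans (cong ∣_∣ (U-double n)) (ℤP.abs-* (U a b n) (V a b n)))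

  v[n]∣u[2n] : ∀ n → v n ∣ u (2 * n)
  v[n]∣u[2n] n = subst (v n ∣_) (sym (u[2n]≡u[n]v[n] n)) (n∣m*n (u n))

  ∣u[n]∣v[n]⇒∣2 : ∀ {d} n → d ∣ u n → d ∣ v n → d ∣ 2
  ∣u[n]∣v[n]⇒∣2 {d} n p q = ℤS.∣⇒∣ᵤ (∣U[n]∣V[n]⇒∣2 n (ℤS.∣ᵤ⇒∣ {+ d} p) (ℤS.∣ᵤ⇒∣ {+ d} q))

  v[h]∣v[hx] : ∀ h {x} → ¬ (2 ∣ x) → v h ∣ v (h * x)
  v[h]∣v[hx] h {x} x-odd = subst (λ z → v h ∣ v z) (sym (odd⇒h*x≡h+[x/2]*2h h x x-odd))
    (ℤS.∣⇒∣ᵤ (V[h]∣V[h+q*2h] h (x / 2)))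

  u-positive : ∀ {k} → 1 ≤ k → 1 ≤ u k
  u-positive {suc k} _ = positive U-growth k

  v-positive : ∀ k → 1 ≤ v k
  v-positive zero    = s≤s z≤n
  v-positive (suc k) = positive V-growth k

  M*u[t]∣u[qt]⇔M∣q : ∀ t q M → 1 ≤ t → M ∣ u t → (M * u t ∣ u (q * t)) ⇔ (M ∣ q)
  M*u[t]∣u[qt]⇔M∣q t       zero    M _ _ = mk⇔ (λ _ → M ∣0) (λ _ → _ ∣0)
  M*u[t]∣u[qt]⇔M∣q (suc t) (suc j) M _ M∣u[t] = mk⇔
    (λ h → ℤS.∣⇒∣ᵤ (Equivalence.to signed
      (ℤS.∣ᵤ⇒∣ {+ M ℤ.* U a b (suc t)} (subst (_∣ u (suc j * suc t)) (sym ∣MU∣) h))))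
    (λ h → subst (_∣ u (suc j * suc t)) ∣MU∣ (ℤS.∣⇒∣ᵤ (Equivalence.from signed (ℤS.∣ᵤ⇒∣ {+ M} {+ suc j} h))))
    where
    U≢0 : U a b (suc t) ≢ + 0
    U≢0 e = contradiction (subst (1 ≤_) (cong ∣_∣ e) (positive U-growth t)) λ ()
    signed = M*U[t]∣U[kt]⇔M∣k (suc t) j (ℤS.∣ᵤ⇒∣ {+ M} M∣u[t]) U≢0
    ∣MU∣ : ∣ + M ℤ.* U a b (suc t) ∣ ≡ M * u (suc t)
    ∣MU∣ = ℤP.abs-* (+ M) (U a b (suc t))

  private
    monotone : (f : ℕ → ℕ) → (∀ k → f (suc k) ≤ f (suc (suc k))) → ∀ {i j} → 1 ≤ i → i ≤ j → f i ≤ f j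
    monotone f step {suc i} {suc j} _ (s≤s i≤j) = go (ℕP.≤⇒≤′ i≤j)
      where
      go : ∀ {j} → i ℕ.≤′ j → f (suc i) ≤ f (suc j)
      go ℕ.≤′-refl       = ℕP.≤-refl
      go (ℕ.≤′-step i≤j) = ℕP.≤-trans (go i≤j) (step _)

    v[1+k]<v[2+k] : ∀ k → v (suc k) < v (suc (suc k))
    v[1+k]<v[2+k] zero    = ∣V₁∣<∣V₂∣
    v[1+k]<v[2+k] (suc k) = increasing V-growth k

  u-strictlyMonotone : ∀ {k m} → 1 ≤ k → k < m → 3 ≤ m → u k < u m
  u-strictlyMonotone {k} {suc (suc (suc m))} 1≤k k<m (s≤s (s≤s (s≤s _))) =
    ℕP.≤-<-trans (monotone u (nondecreasing U-growth) 1≤k (ℕP.≤-pred k<m)) (increasing U-growth m)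

  2v[h]<v[n] : ∀ {h n} → 1 ≤ h → suc (suc h) ≤ n → 2 * v h < v n
  2v[h]<v[n] {suc h} _ h+2≤n = ℕP.<-≤-trans (doubling V-growth h (v[1+k]<v[2+k] h))
    (monotone v (λ k → ℕP.<⇒≤ (v[1+k]<v[2+k] k)) (s≤s z≤n) h+2≤n)

  3≤v[n] : ∀ {n} → 3 ≤ n → 3 ≤ v n
  3≤v[n] {suc (suc (suc n))} (s≤s (s≤s (s≤s _))) =
    ℕP.≤-<-trans (ℕP.*-monoʳ-≤ 2 (v-positive (suc n))) (2v[h]<v[n] {suc n} (s≤s z≤n) ℕP.≤-refl)

  u[m]∣u[s]⇒m∣s : ∀ {m s} → 3 ≤ m → u m ∣ u s → m ∣ s
  u[m]∣u[s]⇒m∣s {m} {s} 3≤m h with gcd m s ℕ.≟ m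
  ... | yes g≡m = subst (_∣ s) g≡m (gcd[m,n]∣n m s)
  ... | no  g≢m = contradiction (m∣n⇒m≤n (u-positive 1≤g) (∣u[m]∣u[n]⇒∣u[gcd[m,n]] m s ∣-refl h))
                                (ℕP.<⇒≱ (u-strictlyMonotone 1≤g g<m 3≤m))
    where
    1≤m : 1 ≤ m
    1≤m = ℕP.≤-trans (s≤s z≤n) 3≤m
    1≤g : 1 ≤ gcd m s
    1≤g = gcd-positive m s 1≤m
    g<m : gcd m s < m
    g<m = ℕP.≤∧≢⇒< (m∣n⇒m≤n 1≤m (gcd[m,n]∣m m s)) g≢m

  v[n]∣u[h]v[h]⇒h≡n : ∀ {n h} → 3 ≤ n → 1 ≤ h → h ∣ n → v n ∣ u h * v h → h ≡ n
  v[n]∣u[h]v[h]⇒h≡n {n} {h} 3≤n 1≤h h∣n v[n]∣uv with h ℕ.≟ n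
  ... | yes h≡n = h≡n
  ... | no  h≢n = contradiction (m∣n⇒m≤n (ℕP.≤-trans (v-positive h) (ℕP.m≤m+n (v h) _)) v[n]∣2v[h])
                                (ℕP.<⇒≱ (2v[h]<v[n] 1≤h (2+h≤n 1≤h (∣∧≢⇒2*≤ 1≤n h∣n h≢n))))
    where
    1≤n : 1 ≤ n
    1≤n = ℕP.≤-trans (s≤s z≤n) 3≤n
    gcd∣2 : gcd (v n) (u h) ∣ 2
    gcd∣2 = ∣u[n]∣v[n]⇒∣2 n (∣-trans (gcd[m,n]∣n (v n) (u h)) (m∣n⇒u[m]∣u[n] h∣n)) (gcd[m,n]∣m (v n) (u h))
    v[n]∣2v[h] : v n ∣ 2 * v h
    v[n]∣2v[h] = ∣-trans (m∣nk⇒m∣gcd[m,n]k (v n) (u h) (v h) v[n]∣uv) (*-monoˡ-∣ (v h) gcd∣2)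
    2+h≤n : ∀ {h} → 1 ≤ h → 2 * h ≤ n → suc (suc h) ≤ n
    2+h≤n {suc zero}     _ _    = 3≤n
    2+h≤n {suc (suc h′)} _ 2h≤n = ℕP.≤-trans (subst (_≤ 2 * x) (ℕP.+-comm x 2)
      (ℕP.+-monoʳ-≤ x (subst (2 ≤_) (sym (ℕP.+-identityʳ x)) (s≤s (s≤s z≤n))))) 2h≤n
      where
      x = suc (suc h′)

  -- g = gcd (2n, s) divides 2h with h = gcd (n, g), so g is h or 2h; since v n ∣ u g, the
  -- first case would give v n ∣ gcd (u n, v n) ∣ 2, and the second forces h = n.
  v[n]∣u[s]⇒2n∣s : ∀ {n s} → 3 ≤ n → v n ∣ u s → 2 * n ∣ s
  v[n]∣u[s]⇒2n∣s {n} {s} 3≤n v[n]∣u[s] =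
    subst (_∣ s) (g≡2n (∣2⇒≡1⊎≡2 q∣2)) (gcd[m,n]∣n (2 * n) s)
    where
    g = gcd (2 * n) s
    h = gcd n g
    1≤h : 1 ≤ h
    1≤h = gcd-positive n g (ℕP.≤-trans (s≤s z≤n) 3≤n)
    h∣n : h ∣ n
    h∣n = gcd[m,n]∣m n g
    v[n]∣u[g] : v n ∣ u g
    v[n]∣u[g] = ∣u[m]∣u[n]⇒∣u[gcd[m,n]] (2 * n) s (v[n]∣u[2n] n) v[n]∣u[s]
    g∣2h : g ∣ 2 * h
    g∣2h = subst (g ∣_) (sym (c*gcd[m,n]≡gcd[cm,cn] 2 n g)) (gcd-greatest (gcd[m,n]∣m (2 * n) s) (n∣m*n 2))
    h∣g : h ∣ g
    h∣g = gcd[m,n]∣n n g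
    q = quotient h∣g
    g≡qh : g ≡ q * h
    g≡qh = m∣n⇒n≡quotient*m h∣g
    q∣2 : q ∣ 2
    q∣2 = *-cancelʳ-∣ h {{1≤⇒nonZero 1≤h}} (subst (_∣ 2 * h) g≡qh g∣2h)
    g≡2n : q ≡ 1 ⊎ q ≡ 2 → g ≡ 2 * n
    g≡2n (inj₁ q≡1) = contradiction (∣u[n]∣v[n]⇒∣2 n (∣-trans v[n]∣u[g] (m∣n⇒u[m]∣u[n] g∣n)) ∣-refl)
                                    (λ v[n]∣2 → ℕP.<⇒≱ (3≤v[n] 3≤n) (∣⇒≤ v[n]∣2))
      where
      g∣n : g ∣ n
      g∣n = subst (_∣ n) (sym (trans g≡qh (trans (cong (_* h) q≡1) (ℕP.*-identityˡ h)))) h∣n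
    g≡2n (inj₂ q≡2) = trans g≡2h (cong (2 *_) (v[n]∣u[h]v[h]⇒h≡n 3≤n 1≤h h∣n v[n]∣u[h]v[h]))
      where
      g≡2h : g ≡ 2 * h
      g≡2h = trans g≡qh (cong (_* h) q≡2)
      v[n]∣u[h]v[h] : v n ∣ u h * v h
      v[n]∣u[h]v[h] = subst (v n ∣_) (trans (cong u g≡2h) (u[2n]≡u[n]v[n] h)) v[n]∣u[g]

  tM∣s⇒Mu[t]∣u[s] : ∀ {t M s} → 1 ≤ t → M ∣ u t → t * M ∣ s → M * u t ∣ u s
  tM∣s⇒Mu[t]∣u[s] {t} {M} {s} 1≤t M∣u[t] (divides c refl) = subst (λ z → M * u t ∣ u z) (regroup c t M)
    (Equivalence.from (M*u[t]∣u[qt]⇔M∣q t (c * M) M 1≤t M∣u[t]) (n∣m*n c))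
    where
    regroup : ∀ c t M → (c * M) * t ≡ c * (t * M)
    regroup = solve-∀

  RankOfApparition : ℕ → ℕ → Set
  RankOfApparition x T = ∀ s → (x ∣ u s) ⇔ (T ∣ s)

  rank-resp-≡ : ∀ {x T T′} → T ≡ T′ → RankOfApparition x T → RankOfApparition x T′
  rank-resp-≡ refl rank = rank

  rank⇒τ≡ : ∀ Z {x T E} → ∣ Z ∣ ≡ x → 1 ≤ T → RankOfApparition x T → + T ≡ E → τ≡ a b Z E
  rank⇒τ≡ Z {T = T} refl 1≤T rank refl =
    T , (1≤T , Equivalence.from (rank T) ∣-refl , λ s 1≤s s<T Z∣U[s] →
           ℕP.<⇒≱ s<T (m∣n⇒m≤n 1≤s (Equivalence.to (rank s) Z∣U[s]))) , refl

  module Parity where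
    import Data.Integer.Divisibility as ℤD
    import Data.Integer.DivMod as ℤDM
    import Data.Integer.Tactic.RingSolver as ℤ-Ring
    open SignedCoprimality

    private
      2∣ᶻ⇒ : ∀ {x} → + 2 ℤD.∣ x → + 2 ℤS.∣ x
      2∣ᶻ⇒ {x} = ℤS.∣ᵤ⇒∣ {+ 2} {x}

      odd⇒2∣x+1 : ∀ x → ¬ (+ 2 ℤD.∣ x) → + 2 ℤS.∣ x ℤ.+ + 1
      odd⇒2∣x+1 x x-odd = go (x ℤDM.%ℕ 2) (ℤDM.n%ℕd<d x 2) (ℤDM.a≡a%ℕn+[a/ℕn]*n x 2)
        where
        r0 : ∀ q → + 0 ℤ.+ q ℤ.* + 2 ≡ q ℤ.* + 2
        r0 = ℤ-Ring.solve-∀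
        r1 : ∀ q → + 1 ℤ.+ q ℤ.* + 2 ℤ.+ + 1 ≡ (q ℤ.+ + 1) ℤ.* + 2
        r1 = ℤ-Ring.solve-∀
        go : ∀ r → r < 2 → x ≡ + r ℤ.+ (x ℤDM./ℕ 2) ℤ.* + 2 → + 2 ℤS.∣ x ℤ.+ + 1
        go zero             _                x≡ = contradiction
          (ℤS.∣⇒∣ᵤ (ℤS.divides {+ 2} {x} (x ℤDM./ℕ 2) (trans x≡ (r0 (x ℤDM./ℕ 2))))) x-odd
        go (suc zero)       _                x≡ = ℤS.divides (x ℤDM./ℕ 2 ℤ.+ + 1) (trans (cong (ℤ._+ + 1) x≡) (r1 (x ℤDM./ℕ 2)))
        go (suc (suc r))    (s≤s (s≤s ())) _

      odd⇒coprimeˢ-2 : ∀ {x} → ¬ (+ 2 ℤD.∣ x) → Coprimeˢ (+ 2) x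
      odd⇒coprimeˢ-2 {x} x-odd {d} p q with ∣2⇒≡1⊎≡2 (ℤS.∣⇒∣ᵤ p)
      ... | inj₁ e = ℤS.∣ᵤ⇒∣ {d} {+ 1} (subst (_∣ 1) (sym e) ∣-refl)
      ... | inj₂ e = contradiction (subst (_∣ ∣ x ∣) e (ℤS.∣⇒∣ᵤ q)) x-odd

      2∤1 : ¬ (2 ∣ 1)
      2∤1 h = contradiction (∣1⇒≡1 h) λ ()

    2∣u[k]⇒2∣v[k] : ∀ k → 2 ∣ u k → 2 ∣ v k
    2∣u[k]⇒2∣v[k] k h = ℤS.∣⇒∣ᵤ (subst (+ 2 ℤS.∣_) (sym (V-from-U k))
      (ℤS.∣m∣n⇒∣m-n (ℤS.∣m⇒∣m*n {+ 2} {+ 2} (U a b (suc k)) ℤS.∣-refl) (ℤS.∣n⇒∣m*n a (ℤS.∣ᵤ⇒∣ {+ 2} h))))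

    odd-a⇒2∣v[k]⇒2∣u[k] : ¬ (+ 2 ℤD.∣ a) → ∀ k → 2 ∣ v k → 2 ∣ u k
    odd-a⇒2∣v[k]⇒2∣u[k] a-odd k h = ℤS.∣⇒∣ᵤ {+ 2} {U a b k} (coprimeˢ-divisor {+ 2} {a} (odd⇒coprimeˢ-2 a-odd)
      (ℤS.∣m+n∣m⇒∣n {+ 2} {V a b k} (subst (+ 2 ℤS.∣_) (sym (V+aU≡2U[1+n] k)) (ℤS.∣n⇒∣m*n (U a b (suc k)) ℤS.∣-refl))
                    (ℤS.∣ᵤ⇒∣ {+ 2} {V a b k} h)))

    even-a⇒2∣v[k] : + 2 ℤD.∣ a → ∀ k → 2 ∣ v k
    even-a⇒2∣v[k] a-even k = ℤS.∣⇒∣ᵤ (subst (+ 2 ℤS.∣_) (sym (V-from-U k))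
      (ℤS.∣m∣n⇒∣m-n (ℤS.∣m⇒∣m*n {+ 2} {+ 2} (U a b (suc k)) ℤS.∣-refl)
                    (ℤS.∣m⇒∣m*n (U a b k) (2∣ᶻ⇒ {a} a-even))))

    even-b⇒odd-a : + 2 ℤD.∣ b → ¬ (+ 2 ℤD.∣ a)
    even-b⇒odd-a b-even a-even = contradiction (a⊥b (a-even , b-even)) λ ()

    even-b⇒odd-u[1+k] : + 2 ℤD.∣ b → ∀ k → ¬ (2 ∣ u (suc k))
    even-b⇒odd-u[1+k] b-even zero    h = 2∤1 h
    even-b⇒odd-u[1+k] b-even (suc k) h = even-b⇒odd-u[1+k] b-even k (ℤS.∣⇒∣ᵤ {+ 2} {U a b (suc k)}
      (coprimeˢ-divisor {+ 2} {a} (odd⇒coprimeˢ-2 (even-b⇒odd-a b-even))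
        (ℤS.∣m+n∣n⇒∣m {+ 2} {a ℤ.* U a b (suc k)} (ℤS.∣ᵤ⇒∣ {+ 2} {U a b (suc (suc k))} h)
                      (ℤS.∣m⇒∣m*n (U a b k) (2∣ᶻ⇒ {b} b-even)))))

    even-b⇒odd-v[1+k] : + 2 ℤD.∣ b → ∀ k → ¬ (2 ∣ v (suc k))
    even-b⇒odd-v[1+k] b-even k h =
      even-b⇒odd-u[1+k] b-even k (odd-a⇒2∣v[k]⇒2∣u[k] (even-b⇒odd-a b-even) (suc k) h)

    odd-a∧odd-b⇒2∣u[k]⇔3∣k : ¬ (+ 2 ℤD.∣ a) → ¬ (+ 2 ℤD.∣ b) → ∀ k → (2 ∣ u k) ⇔ (3 ∣ k)
    odd-a∧odd-b⇒2∣u[k]⇔3∣k a-odd b-odd k = mk⇔ to (λ 3∣k → ∣-trans 2∣u[3] (m∣n⇒u[m]∣u[n] 3∣k))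
      where
      U₃≡ : ∀ a b → a ℤ.* (a ℤ.* + 1 ℤ.+ b ℤ.* + 0) ℤ.+ b ℤ.* + 1
                  ≡ (a ℤ.+ + 1) ℤ.* (a ℤ.+ + 1) ℤ.- + 2 ℤ.* (a ℤ.+ + 1) ℤ.+ (b ℤ.+ + 1)
      U₃≡ = ℤ-Ring.solve-∀
      2∣u[3] : 2 ∣ u 3
      2∣u[3] = ℤS.∣⇒∣ᵤ (subst (+ 2 ℤS.∣_) (sym (U₃≡ a b))
        (ℤS.∣m∣n⇒∣m+n (ℤS.∣m∣n⇒∣m-n (ℤS.∣m⇒∣m*n (a ℤ.+ + 1) (odd⇒2∣x+1 a a-odd))
                                     (ℤS.∣m⇒∣m*n {+ 2} {+ 2} (a ℤ.+ + 1) ℤS.∣-refl))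
                      (odd⇒2∣x+1 b b-odd)))
      to : 2 ∣ u k → 3 ∣ k
      to h with ∣3⇒≡1⊎≡3 (gcd[m,n]∣n k 3)
      ... | inj₁ g≡1 = contradiction (subst (λ z → 2 ∣ u z) g≡1 (∣u[m]∣u[n]⇒∣u[gcd[m,n]] k 3 h 2∣u[3])) 2∤1
      ... | inj₂ g≡3 = subst (_∣ k) g≡3 (gcd[m,n]∣m k 3)

    even-a⇒2∣u[k]⇔2∣k : + 2 ℤD.∣ a → ∀ k → (2 ∣ u k) ⇔ (2 ∣ k)
    even-a⇒2∣u[k]⇔2∣k a-even k = mk⇔ to (λ 2∣k → ∣-trans 2∣u[2] (m∣n⇒u[m]∣u[n] 2∣k))
      where
      2∣u[2] : 2 ∣ u 2
      2∣u[2] = subst (2 ∣_) (cong ∣_∣ (sym (LucasGrowth.U₂≡a a b))) a-even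
      to : 2 ∣ u k → 2 ∣ k
      to h with ∣2⇒≡1⊎≡2 (gcd[m,n]∣n k 2)
      ... | inj₁ g≡1 = contradiction (subst (λ z → 2 ∣ u z) g≡1 (∣u[m]∣u[n]⇒∣u[gcd[m,n]] k 2 h 2∣u[2])) 2∤1
      ... | inj₂ g≡2 = subst (_∣ k) g≡2 (gcd[m,n]∣m k 2)

module OrdersOfAppearance (a b : ℤ) (a⊥b : ℤC.Coprime a b) (G : LucasGrowth.LucasGrowth a b)
              (m n : ℕ) (3≤m : 3 ℕ.≤ m) (3≤n : 3 ℕ.≤ n) where
  open import Data.Nat using (_+_; _*_; _≤_; _<_)
  open import Data.Nat.Divisibility
  open import Data.Nat.GCD using (gcd; gcd[m,n]∣m; gcd[m,n]∣n; gcd-greatest; c*gcd[m,n]≡gcd[cm,cn])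
  open import Data.Nat.LCM using (lcm; m∣lcm[m,n]; n∣lcm[m,n]; lcm-least; gcd*lcm)
  open import Data.Nat.Coprimality using (Coprime; coprime-divisor; coprime-factors; coprime⇒gcd≡1)
  open import Data.Nat.Tactic.RingSolver using (solve-∀)
  open NatDivisibility
  open PositiveLucas a b a⊥b G
  open GcdDecomposition

  1≤m : 1 ≤ m
  1≤m = ℕP.≤-trans (s≤s z≤n) 3≤m
  1≤n : 1 ≤ n
  1≤n = ℕP.≤-trans (s≤s z≤n) 3≤n

  D = decompose m n 1≤m 1≤n
  open Decomposition D public
  open TwoAdicComparison D

  d = gcd m n
  l = lcm m n

  private
    instance
      _ = 1≤⇒nonZero 1≤d

    d∣m = gcd[m,n]∣m m n
    d∣n = gcd[m,n]∣n m n
    m∣l = m∣lcm[m,n] m n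
    n∣l = n∣lcm[m,n] m n

    l≡mn′ : l ≡ m * n′
    l≡mn′ = trans lcm≡dm′n′ (cong (_* n′) (sym m≡dm′))

    l≡nm′ : l ≡ n * m′
    l≡nm′ = trans lcm≡dm′n′ (trans (regroup d m′ n′) (cong (_* m′) (sym n≡dn′)))
      where
      regroup : ∀ d p q → d * p * q ≡ d * q * p
      regroup = solve-∀

    jl≡[n′j]m : ∀ j → j * l ≡ (n′ * j) * m
    jl≡[n′j]m j = trans (cong (j *_) l≡mn′) (regroup j m n′)
      where
      regroup : ∀ j x y → j * (x * y) ≡ (y * j) * x
      regroup = solve-∀

    jl≡[m′j]n : ∀ j → j * l ≡ (m′ * j) * n
    jl≡[m′j]n j = trans (cong (j *_) l≡nm′) (regroup j n m′)
      where
      regroup : ∀ j x y → j * (x * y) ≡ (y * j) * x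
      regroup = solve-∀

    gcd[u[m],u[n]]∣u[d] : gcd (u m) (u n) ∣ u d
    gcd[u[m],u[n]]∣u[d] = ∣u[m]∣u[n]⇒∣u[gcd[m,n]] m n (gcd[m,n]∣m (u m) (u n)) (gcd[m,n]∣n (u m) (u n))

  1≤l : 1 ≤ l
  1≤l = subst (1 ≤_) (sym l≡mn′) (1≤* 1≤m 1≤n′)

  rank-u[m]u[n] : RankOfApparition (u m * u n) (l * u d)
  rank-u[m]u[n] s = mk⇔ to from
    where
    to : u m * u n ∣ u s → l * u d ∣ s
    to h = subst (l * u d ∣_) (sym s≡jl) (subst (_∣ j * l) (ℕP.*-comm (u d) l) (*-monoˡ-∣ l u[d]∣j))
      where
      l∣s : l ∣ s
      l∣s = lcm-least (u[m]∣u[s]⇒m∣s 3≤m (∣-trans (m∣m*n (u n)) h)) (u[m]∣u[s]⇒m∣s 3≤n (∣-trans (n∣m*n (u m)) h))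
      j = quotient l∣s
      s≡jl : s ≡ j * l
      s≡jl = m∣n⇒n≡quotient*m l∣s
      u[d]u[m]∣u[s] : u d * u m ∣ u s
      u[d]u[m]∣u[s] = ∣-trans (*-monoˡ-∣ (u m) (m∣n⇒u[m]∣u[n] d∣n)) (subst (_∣ u s) (ℕP.*-comm (u m) (u n)) h)
      u[d]u[n]∣u[s] : u d * u n ∣ u s
      u[d]u[n]∣u[s] = ∣-trans (*-monoˡ-∣ (u n) (m∣n⇒u[m]∣u[n] d∣m)) h
      u[d]∣n′j : u d ∣ n′ * j
      u[d]∣n′j = Equivalence.to (M*u[t]∣u[qt]⇔M∣q m (n′ * j) (u d) 1≤m (m∣n⇒u[m]∣u[n] d∣m))
        (subst (λ z → u d * u m ∣ u z) (trans s≡jl (jl≡[n′j]m j)) u[d]u[m]∣u[s])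
      u[d]∣m′j : u d ∣ m′ * j
      u[d]∣m′j = Equivalence.to (M*u[t]∣u[qt]⇔M∣q n (m′ * j) (u d) 1≤n (m∣n⇒u[m]∣u[n] d∣n))
        (subst (λ z → u d * u n ∣ u z) (trans s≡jl (jl≡[m′j]n j)) u[d]u[n]∣u[s])
      u[d]∣j : u d ∣ j
      u[d]∣j = coprime-factors coprime (u[d]∣m′j , u[d]∣n′j)
    from : l * u d ∣ s → u m * u n ∣ u s
    from h = ∣-trans u[m]u[n]∣u[d]u[l] (tM∣s⇒Mu[t]∣u[s] 1≤l (m∣n⇒u[m]∣u[n] (∣-trans d∣m m∣l)) h)
      where
      u[m]u[n]∣u[d]u[l] : u m * u n ∣ u d * u l
      u[m]u[n]∣u[d]u[l] = ∣-trans (m∣k∧n∣k⇒mn∣k*gcd[m,n] (m∣n⇒u[m]∣u[n] m∣l) (m∣n⇒u[m]∣u[n] n∣l))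
        (subst (u l * gcd (u m) (u n) ∣_) (ℕP.*-comm (u l) (u d)) (*-monoʳ-∣ (u l) gcd[u[m],u[n]]∣u[d]))

  rank-u[m]v[n]-odd : ¬ (2 ∣ m′) → RankOfApparition (u m * v n) (2 * l)
  rank-u[m]v[n]-odd m′-odd s = mk⇔ to from
    where
    to : u m * v n ∣ u s → 2 * l ∣ s
    to h = subst (2 * l ∣_) (sym s≡r[2l]) (n∣m*n r)
      where
      m∣s = u[m]∣u[s]⇒m∣s 3≤m (∣-trans (m∣m*n (v n)) h)
      2n∣s = v[n]∣u[s]⇒2n∣s 3≤n (∣-trans (n∣m*n (u m)) h)
      q = quotient 2n∣s
      s≡q[2n] : s ≡ q * (2 * n)
      s≡q[2n] = m∣n⇒n≡quotient*m 2n∣s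
      regroup₁ : ∀ q d n′ → q * (2 * (d * n′)) ≡ d * (2 * (n′ * q))
      regroup₁ = solve-∀
      m′∣q : m′ ∣ q
      m′∣q = coprime-divisor coprime (odd∣2n⇒∣n m′-odd (*-cancelˡ-∣ d
        (subst₂ _∣_ m≡dm′ (trans s≡q[2n] (trans (cong (λ z → q * (2 * z)) n≡dn′) (regroup₁ q d n′))) m∣s)))
      r = quotient m′∣q
      regroup₂ : ∀ r m′ d n′ → r * m′ * (2 * (d * n′)) ≡ r * (2 * (d * m′ * n′))
      regroup₂ = solve-∀
      s≡r[2l] : s ≡ r * (2 * l)
      s≡r[2l] = trans s≡q[2n] (trans (cong (_* (2 * n)) (m∣n⇒n≡quotient*m m′∣q))
        (trans (cong (λ z → r * m′ * (2 * z)) n≡dn′)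
          (trans (regroup₂ r m′ d n′) (cong (λ z → r * (2 * z)) (sym lcm≡dm′n′)))))
    from : 2 * l ∣ s → u m * v n ∣ u s
    from h = ∣-trans (subst (u m * v n ∣_) (sym (u[2n]≡u[n]v[n] l))
      (*-pres-∣ (m∣n⇒u[m]∣u[n] m∣l) (subst (λ z → v n ∣ v z) (sym l≡nm′) (v[h]∣v[hx] n m′-odd))))
      (m∣n⇒u[m]∣u[n] h)

  module EvenCofactor (m₂ : ℕ) (m′≡m₂2 : m′ ≡ m₂ * 2) where
    n′-odd : ¬ (2 ∣ n′)
    n′-odd = even-m′⇒odd-n′ (divides m₂ m′≡m₂2)
  
    m₂-coprime-n′ : Coprime m₂ n′
    m₂-coprime-n′ (p , q) = coprime (∣-trans p (divides 2 (trans m′≡m₂2 (ℕP.*-comm m₂ 2))) , q)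

    m≡m₂[2d] : m ≡ m₂ * (2 * d)
    m≡m₂[2d] = trans m≡dm′ (trans (cong (d *_) m′≡m₂2) (regroup d m₂))
      where
      regroup : ∀ d m₂ → d * (m₂ * 2) ≡ m₂ * (2 * d)
      regroup = solve-∀

    l≡m₂[2n] : l ≡ m₂ * (2 * n)
    l≡m₂[2n] = trans lcm≡dm′n′ (trans (cong (λ z → d * z * n′) m′≡m₂2)
      (trans (regroup d m₂ n′) (cong (λ z → m₂ * (2 * z)) (sym n≡dn′))))
      where
      regroup : ∀ d m₂ n′ → d * (m₂ * 2) * n′ ≡ m₂ * (2 * (d * n′))
      regroup = solve-∀

    v[d]∣v[n] : v d ∣ v n
    v[d]∣v[n] = subst (λ z → v d ∣ v z) (sym n≡dn′) (v[h]∣v[hx] d n′-odd)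

    u[d]v[d]∣u[m] : u d * v d ∣ u m
    u[d]v[d]∣u[m] = subst (_∣ u m) (u[2n]≡u[n]v[n] d) (m∣n⇒u[m]∣u[n] (divides m₂ m≡m₂[2d]))

    v[d]∣u[m] : v d ∣ u m
    v[d]∣u[m] = ∣-trans (n∣m*n (u d)) u[d]v[d]∣u[m]

    gcd[m,2n]≡2d : gcd m (2 * n) ≡ 2 * d
    gcd[m,2n]≡2d = trans (cong₂ gcd (trans m≡m₂[2d] (ℕP.*-comm m₂ (2 * d))) (trans (cong (2 *_) n≡dn′) (regroup d n′)))
      (trans (sym (c*gcd[m,n]≡gcd[cm,cn] (2 * d) m₂ n′))
             (trans (cong ((2 * d) *_) (coprime⇒gcd≡1 m₂-coprime-n′)) (ℕP.*-identityʳ (2 * d))))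
      where
      regroup : ∀ d n′ → 2 * (d * n′) ≡ 2 * d * n′
      regroup = solve-∀

    -- gcd (u m v n, u (2n)) divides W = u d v n, so u m v n u (2n) ∣ u s W; cancel W
    -- after replacing u m by its factor u d v d.
    v[d]u[2n]∣u[s] : ∀ {s} → u m * v n ∣ u s → 2 * n ∣ s → v d * u (2 * n) ∣ u s
    v[d]u[2n]∣u[s] {s} h 2n∣s = *-cancelʳ-∣ W {{1≤⇒nonZero (1≤* (u-positive 1≤d) (v-positive n))}}
      (∣-trans lhs∣ (∣-trans (m∣k∧n∣k⇒mn∣k*gcd[m,n] h (m∣n⇒u[m]∣u[n] 2n∣s)) (*-monoʳ-∣ (u s) gcd∣W)))
      where
      W = u d * v n
      gcd∣W : gcd (u m * v n) (u (2 * n)) ∣ W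
      gcd∣W = subst (λ z → gcd (u m * v n) z ∣ W) (sym (u[2n]≡u[n]v[n] n))
        (subst (_∣ W) (sym (gcd[mk,nk]≡gcd[m,n]k (u m) (u n) (v n))) (*-monoˡ-∣ (v n) gcd[u[m],u[n]]∣u[d]))
      regroup₁ : ∀ vd un vn ud um → (vd * (un * vn)) * (ud * vn) ≡ (ud * vd) * (un * vn * vn)
      regroup₁ = solve-∀
      regroup₂ : ∀ un vn um → (um * vn) * (un * vn) ≡ um * (un * vn * vn)
      regroup₂ = solve-∀
      lhs∣ : (v d * u (2 * n)) * W ∣ (u m * v n) * u (2 * n)
      lhs∣ = subst₂ _∣_
        (sym (trans (cong (λ z → (v d * z) * W) (u[2n]≡u[n]v[n] n)) (regroup₁ (v d) (u n) (v n) (u d) (u m))))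
        (sym (trans (cong ((u m * v n) *_) (u[2n]≡u[n]v[n] n)) (regroup₂ (u n) (v n) (u m))))
        (*-monoˡ-∣ (u n * v n * v n) u[d]v[d]∣u[m])

    u[m]v[n]∣v[d]u[l] : u m * v n ∣ v d * u l
    u[m]v[n]∣v[d]u[l] = ∣-trans (m∣m*n w) (*-cancelˡ-∣ (u d) {{1≤⇒nonZero (u-positive 1≤d)}}
      (subst₂ _∣_ (trans (cong (λ z → u m * (z * v n)) u[n]≡wu[d]) (sym (regroup₁ (u d) (u m) (v n) w)))
                  (regroup₂ (u d) (v d) (u l)) u[m]u[n]v[n]∣u[l]u[d]v[d]))
      where
      gcd∣u[d]v[d] : gcd (u m) (u (2 * n)) ∣ u d * v d
      gcd∣u[d]v[d] = subst (gcd (u m) (u (2 * n)) ∣_) (trans (cong u gcd[m,2n]≡2d) (u[2n]≡u[n]v[n] d))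
        (∣u[m]∣u[n]⇒∣u[gcd[m,n]] m (2 * n) (gcd[m,n]∣m (u m) (u (2 * n))) (gcd[m,n]∣n (u m) (u (2 * n))))
      u[m]u[n]v[n]∣u[l]u[d]v[d] : u m * (u n * v n) ∣ u l * (u d * v d)
      u[m]u[n]v[n]∣u[l]u[d]v[d] = subst (λ z → u m * z ∣ u l * (u d * v d)) (u[2n]≡u[n]v[n] n)
        (∣-trans (m∣k∧n∣k⇒mn∣k*gcd[m,n] (m∣n⇒u[m]∣u[n] m∣l) (m∣n⇒u[m]∣u[n] (divides m₂ l≡m₂[2n])))
                 (*-monoʳ-∣ (u l) gcd∣u[d]v[d]))
      w = quotient (m∣n⇒u[m]∣u[n] d∣n)
      u[n]≡wu[d] : u n ≡ w * u d
      u[n]≡wu[d] = m∣n⇒n≡quotient*m (m∣n⇒u[m]∣u[n] d∣n)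
      regroup₁ : ∀ ud um vn w → ud * (um * vn * w) ≡ um * (w * ud * vn)
      regroup₁ = solve-∀
      regroup₂ : ∀ ud vd ul → ul * (ud * vd) ≡ ud * (vd * ul)
      regroup₂ = solve-∀

    rank-u[m]v[n] : RankOfApparition (u m * v n) (l * v d)
    rank-u[m]v[n] s = mk⇔ to from
      where
      to : u m * v n ∣ u s → l * v d ∣ s
      to h = subst (l * v d ∣_) (sym s≡jl) (subst (_∣ j * l) (ℕP.*-comm (v d) l) (*-monoˡ-∣ l v[d]∣j))
        where
        m∣s = u[m]∣u[s]⇒m∣s 3≤m (∣-trans (m∣m*n (v n)) h)
        2n∣s = v[n]∣u[s]⇒2n∣s 3≤n (∣-trans (n∣m*n (u m)) h)
        q = quotient 2n∣s
        s≡q[2n] : s ≡ q * (2 * n)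
        s≡q[2n] = m∣n⇒n≡quotient*m 2n∣s
        regroup₁ : ∀ d m₂ → m₂ * (2 * d) ≡ 2 * d * m₂
        regroup₁ = solve-∀
        regroup₂ : ∀ q d n′ → q * (2 * (d * n′)) ≡ 2 * d * (n′ * q)
        regroup₂ = solve-∀
        m₂∣q : m₂ ∣ q
        m₂∣q = coprime-divisor m₂-coprime-n′ (*-cancelˡ-∣ (2 * d) {{1≤⇒nonZero (1≤* {2} (s≤s z≤n) 1≤d)}}
          (subst₂ _∣_ (trans m≡m₂[2d] (regroup₁ d m₂))
                      (trans s≡q[2n] (trans (cong (λ z → q * (2 * z)) n≡dn′) (regroup₂ q d n′))) m∣s))
        j = quotient m₂∣q
        s≡jl : s ≡ j * l
        s≡jl = trans s≡q[2n] (trans (cong (_* (2 * n)) (m∣n⇒n≡quotient*m m₂∣q))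
          (trans (ℕP.*-assoc j m₂ (2 * n)) (cong (j *_) (sym l≡m₂[2n]))))
        v[d]∣n′j : v d ∣ n′ * j
        v[d]∣n′j = Equivalence.to (M*u[t]∣u[qt]⇔M∣q m (n′ * j) (v d) 1≤m v[d]∣u[m])
          (subst (λ z → v d * u m ∣ u z) (trans s≡jl (jl≡[n′j]m j))
            (∣-trans (*-monoˡ-∣ (u m) v[d]∣v[n]) (subst (_∣ u s) (ℕP.*-comm (u m) (v n)) h)))
        regroup₃ : ∀ j x y → j * (x * y) ≡ (x * j) * y
        regroup₃ = solve-∀
        v[d]∣m₂j : v d ∣ m₂ * j
        v[d]∣m₂j = Equivalence.to
          (M*u[t]∣u[qt]⇔M∣q (2 * n) (m₂ * j) (v d) (ℕP.≤-trans 1≤n (ℕP.m≤m+n n _)) (∣-trans v[d]∣v[n] (v[n]∣u[2n] n)))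
          (subst (λ z → v d * u (2 * n) ∣ u z) (trans s≡jl (trans (cong (j *_) l≡m₂[2n]) (regroup₃ j m₂ (2 * n))))
            (v[d]u[2n]∣u[s] h 2n∣s))
        v[d]∣j : v d ∣ j
        v[d]∣j = coprime-factors m₂-coprime-n′ (v[d]∣m₂j , v[d]∣n′j)
      from : l * v d ∣ s → u m * v n ∣ u s
      from h = ∣-trans u[m]v[n]∣v[d]u[l] (tM∣s⇒Mu[t]∣u[s] 1≤l (∣-trans v[d]∣u[m] (m∣n⇒u[m]∣u[n] m∣l)) h)

  rank-u[m]v[n]-ν₂[m]≤ν₂[n] : ν₂ m ≤ ν₂ n → RankOfApparition (u m * v n) (2 * l)
  rank-u[m]v[n]-ν₂[m]≤ν₂[n] ν₂[m]≤ν₂[n] = rank-u[m]v[n]-odd (ν₂[m]≤ν₂[n]⇒odd-m′ ν₂[m]≤ν₂[n])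

  rank-u[m]v[n]-ν₂[n]<ν₂[m] : ν₂ n < ν₂ m → RankOfApparition (u m * v n) (l * v d)
  rank-u[m]v[n]-ν₂[n]<ν₂[m] ν₂[n]<ν₂[m] with ν₂[n]<ν₂[m]⇒even-m′ ν₂[n]<ν₂[m]
  ... | divides m₂ m′≡m₂2 = EvenCofactor.rank-u[m]v[n] m₂ m′≡m₂2

  g = gcd (v m) (v n)

  private
    g∣v[m] = gcd[m,n]∣m (v m) (v n)
    g∣v[n] = gcd[m,n]∣n (v m) (v n)

    1≤2l : 1 ≤ 2 * l
    1≤2l = ℕP.≤-trans 1≤l (ℕP.m≤m+n l _)

    v[m]v[n]∣u[s]⇒2l∣s : ∀ {s} → v m * v n ∣ u s → 2 * l ∣ s
    v[m]v[n]∣u[s]⇒2l∣s {s} h = subst (2 * l ∣_) (sym s≡2qm) (*-monoʳ-∣ 2 (lcm-least (n∣m*n q) n∣qm))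
      where
      2m∣s = v[n]∣u[s]⇒2n∣s 3≤m (∣-trans (m∣m*n (v n)) h)
      2n∣s = v[n]∣u[s]⇒2n∣s 3≤n (∣-trans (n∣m*n (v m)) h)
      q = quotient 2m∣s
      regroup : ∀ q m → q * (2 * m) ≡ 2 * (q * m)
      regroup = solve-∀
      s≡2qm : s ≡ 2 * (q * m)
      s≡2qm = trans (m∣n⇒n≡quotient*m 2m∣s) (regroup q m)
      n∣qm : n ∣ q * m
      n∣qm = *-cancelˡ-∣ 2 (subst (2 * n ∣_) s≡2qm 2n∣s)

    -- gcd (v p v q, u (2p)) = gcd (v q, u p) v p divides e v p, and cancelling e v p from
    -- v p v q u (2p) ∣ u s gcd (v p v q, u (2p)) leaves M u (2p) ∣ u s.
    Mu[2p]∣u[s] : ∀ {p q M e s} → 1 ≤ e → v p * v q ∣ u s → 2 * p ∣ s →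
                  gcd (v q) (u p) ∣ e → M * e ∣ v q → M * u (2 * p) ∣ u s
    Mu[2p]∣u[s] {p} {q} {M} {e} {s} 1≤e h 2p∣s gcd∣e Me∣v[q] =
      *-cancelʳ-∣ (e * v p) {{1≤⇒nonZero (1≤* 1≤e (v-positive p))}}
        (∣-trans lhs∣ (∣-trans (m∣k∧n∣k⇒mn∣k*gcd[m,n] h (m∣n⇒u[m]∣u[n] 2p∣s)) (*-monoʳ-∣ (u s) gcd∣ev[p])))
      where
      gcd∣ev[p] : gcd (v p * v q) (u (2 * p)) ∣ e * v p
      gcd∣ev[p] = subst₂ (λ z w → gcd z w ∣ e * v p) (ℕP.*-comm (v q) (v p)) (sym (u[2n]≡u[n]v[n] p))
        (subst (_∣ e * v p) (sym (gcd[mk,nk]≡gcd[m,n]k (v q) (u p) (v p))) (*-monoˡ-∣ (v p) gcd∣e))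
      regroup₁ : ∀ M e u₂ vp → (M * u₂) * (e * vp) ≡ (M * e) * (u₂ * vp)
      regroup₁ = solve-∀
      regroup₂ : ∀ vp vq u₂ → (vp * vq) * u₂ ≡ vq * (u₂ * vp)
      regroup₂ = solve-∀
      lhs∣ : (M * u (2 * p)) * (e * v p) ∣ (v p * v q) * u (2 * p)
      lhs∣ = subst₂ _∣_ (sym (regroup₁ M e (u (2 * p)) (v p))) (sym (regroup₂ (v p) (v q) (u (2 * p))))
        (*-monoˡ-∣ (u (2 * p) * v p) Me∣v[q])

    v[m]v[n]∣u[s]⇒2lM∣s : ∀ M e → 1 ≤ e → M * e ∣ v m → M * e ∣ v n →
      gcd (v n) (u m) ∣ e → gcd (v m) (u n) ∣ e → ∀ {s} → v m * v n ∣ u s → 2 * l * M ∣ s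
    v[m]v[n]∣u[s]⇒2lM∣s M e 1≤e Me∣v[m] Me∣v[n] gcd₁∣e gcd₂∣e {s} h =
      subst (2 * l * M ∣_) (sym s≡j[2l]) (subst (_∣ j * (2 * l)) (ℕP.*-comm M (2 * l)) (*-monoˡ-∣ (2 * l) M∣j))
      where
      2l∣s = v[m]v[n]∣u[s]⇒2l∣s h
      j = quotient 2l∣s
      s≡j[2l] : s ≡ j * (2 * l)
      s≡j[2l] = m∣n⇒n≡quotient*m 2l∣s
      regroup : ∀ j p q → j * (2 * (p * q)) ≡ (q * j) * (2 * p)
      regroup = solve-∀
      M∣n′j : M ∣ n′ * j
      M∣n′j = Equivalence.to
        (M*u[t]∣u[qt]⇔M∣q (2 * m) (n′ * j) M (ℕP.≤-trans 1≤m (ℕP.m≤m+n m _))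
                          (∣-trans (m∣m*n e) (∣-trans Me∣v[m] (v[n]∣u[2n] m))))
        (subst (λ z → M * u (2 * m) ∣ u z) (trans s≡j[2l] (trans (cong (λ z → j * (2 * z)) l≡mn′) (regroup j m n′)))
          (Mu[2p]∣u[s] {m} {n} {M} {e} {s} 1≤e h (v[n]∣u[s]⇒2n∣s 3≤m (∣-trans (m∣m*n (v n)) h)) gcd₁∣e Me∣v[n]))
      M∣m′j : M ∣ m′ * j
      M∣m′j = Equivalence.to
        (M*u[t]∣u[qt]⇔M∣q (2 * n) (m′ * j) M (ℕP.≤-trans 1≤n (ℕP.m≤m+n n _))
                          (∣-trans (m∣m*n e) (∣-trans Me∣v[n] (v[n]∣u[2n] n))))
        (subst (λ z → M * u (2 * n) ∣ u z) (trans s≡j[2l] (trans (cong (λ z → j * (2 * z)) l≡nm′) (regroup j n m′)))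
          (Mu[2p]∣u[s] {n} {m} {M} {e} {s} 1≤e (subst (_∣ u s) (ℕP.*-comm (v m) (v n)) h)
                       (v[n]∣u[s]⇒2n∣s 3≤n (∣-trans (n∣m*n (v m)) h)) gcd₂∣e Me∣v[m]))
      M∣j : M ∣ j
      M∣j = coprime-factors coprime (M∣m′j , M∣n′j)

    g∣2 : ∀ {k} → g ∣ v k → 2 * d ∣ k → g ∣ 2
    g∣2 {k} g∣v[k] 2d∣k = ∣u[n]∣v[n]⇒∣2 k (∣-trans g∣u[2d] (m∣n⇒u[m]∣u[n] 2d∣k)) g∣v[k]
      where
      g∣u[2d] : g ∣ u (2 * d)
      g∣u[2d] = subst (λ z → g ∣ u z) (sym (c*gcd[m,n]≡gcd[cm,cn] 2 m n))
        (∣u[m]∣u[n]⇒∣u[gcd[m,n]] (2 * m) (2 * n) (∣-trans g∣v[m] (v[n]∣u[2n] m)) (∣-trans g∣v[n] (v[n]∣u[2n] n)))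

    2d∣dk : ∀ {k} k₂ → k ≡ k₂ * 2 → 2 * d ∣ d * k
    2d∣dk k₂ refl = divides k₂ (regroup k₂ d)
      where
      regroup : ∀ k₂ d → d * (k₂ * 2) ≡ k₂ * (2 * d)
      regroup = solve-∀

    2k∣l : ∀ k {k′} c → l ≡ k * k′ → k′ ≡ c * 2 → 2 * k ∣ l
    2k∣l k c l≡ refl = divides c (trans l≡ (regroup k c))
      where
      regroup : ∀ k c → k * (c * 2) ≡ c * (2 * k)
      regroup = solve-∀

  rank-v[m]v[n]-one-even : (2 ∣ m′) ⊎ (2 ∣ n′) → RankOfApparition (v m * v n) (2 * l) × g ∣ 2
  rank-v[m]v[n]-one-even cofactor-even =
    (λ s → mk⇔ v[m]v[n]∣u[s]⇒2l∣s (λ 2l∣s → ∣-trans v[m]v[n]∣u[2l] (m∣n⇒u[m]∣u[n] 2l∣s))) , g∣2′ cofactor-even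
    where
    v[m]v[n]∣u[l]v[l] : (2 ∣ m′) ⊎ (2 ∣ n′) → v m * v n ∣ u l * v l
    v[m]v[n]∣u[l]v[l] (inj₁ m′-even@(divides m₂ m′≡)) = subst (_∣ u l * v l) (ℕP.*-comm (v n) (v m))
      (*-pres-∣ (∣-trans (v[n]∣u[2n] n) (m∣n⇒u[m]∣u[n] (2k∣l n m₂ l≡nm′ m′≡)))
                (subst (λ z → v m ∣ v z) (sym l≡mn′) (v[h]∣v[hx] m (even-m′⇒odd-n′ m′-even))))
    v[m]v[n]∣u[l]v[l] (inj₂ n′-even@(divides n₂ n′≡)) =
      *-pres-∣ (∣-trans (v[n]∣u[2n] m) (m∣n⇒u[m]∣u[n] (2k∣l m n₂ l≡mn′ n′≡)))
               (subst (λ z → v n ∣ v z) (sym l≡nm′) (v[h]∣v[hx] n (even-n′⇒odd-m′ n′-even)))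
    v[m]v[n]∣u[2l] : v m * v n ∣ u (2 * l)
    v[m]v[n]∣u[2l] = subst (v m * v n ∣_) (sym (u[2n]≡u[n]v[n] l)) (v[m]v[n]∣u[l]v[l] cofactor-even)
    g∣2′ : (2 ∣ m′) ⊎ (2 ∣ n′) → g ∣ 2
    g∣2′ (inj₁ (divides m₂ m′≡)) = g∣2 g∣v[m] (subst (2 * d ∣_) (sym m≡dm′) (2d∣dk m₂ m′≡))
    g∣2′ (inj₂ (divides n₂ n′≡)) = g∣2 g∣v[n] (subst (2 * d ∣_) (sym n≡dn′) (2d∣dk n₂ n′≡))

  module BothCofactorsOdd (m′-odd : ¬ (2 ∣ m′)) (n′-odd : ¬ (2 ∣ n′)) where
    private
      v[m]∣v[l] : v m ∣ v l
      v[m]∣v[l] = subst (λ z → v m ∣ v z) (sym l≡mn′) (v[h]∣v[hx] m n′-odd)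

      v[n]∣v[l] : v n ∣ v l
      v[n]∣v[l] = subst (λ z → v n ∣ v z) (sym l≡nm′) (v[h]∣v[hx] n m′-odd)

      g∣u[2l] : g ∣ u (2 * l)
      g∣u[2l] = ∣-trans (∣-trans g∣v[m] v[m]∣v[l]) (v[n]∣u[2n] l)

      v[m]v[n]∣gv[l] : v m * v n ∣ g * v l
      v[m]v[n]∣gv[l] = subst (_∣ g * v l) (gcd*lcm (v m) (v n)) (*-monoʳ-∣ g (lcm-least v[m]∣v[l] v[n]∣v[l]))

      gcd[v[p],u[q]]∣2 : ∀ {p q p′ q′} → p ≡ d * p′ → q ≡ d * q′ → Coprime q′ p′ → ¬ (2 ∣ q′) →
                         gcd (v p) (u q) ∣ 2
      gcd[v[p],u[q]]∣2 {p} {q} {p′} {q′} p≡ q≡ q′⊥p′ q′-odd =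
        ∣u[n]∣v[n]⇒∣2 p (∣-trans gcd∣u[d] (m∣n⇒u[m]∣u[n] (divides p′ (trans p≡ (ℕP.*-comm d p′)))))
                        (gcd[m,n]∣m (v p) (u q))
        where
        gcd[2p′,q′]≡1 : gcd (2 * p′) q′ ≡ 1
        gcd[2p′,q′]≡1 = coprime⇒gcd≡1 λ (i∣2p′ , i∣q′) →
          q′⊥p′ (i∣q′ , odd∣2n⇒∣n (λ 2∣i → q′-odd (∣-trans 2∣i i∣q′)) i∣2p′)
        regroup : ∀ d p′ → 2 * (d * p′) ≡ d * (2 * p′)
        regroup = solve-∀
        gcd[2p,q]≡d : gcd (2 * p) q ≡ d
        gcd[2p,q]≡d = trans (cong₂ gcd (trans (cong (2 *_) p≡) (regroup d p′)) q≡)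
          (trans (sym (c*gcd[m,n]≡gcd[cm,cn] d (2 * p′) q′)) (trans (cong (d *_) gcd[2p′,q′]≡1) (ℕP.*-identityʳ d)))
        gcd∣u[d] : gcd (v p) (u q) ∣ u d
        gcd∣u[d] = subst (λ z → gcd (v p) (u q) ∣ u z) gcd[2p,q]≡d
          (∣u[m]∣u[n]⇒∣u[gcd[m,n]] (2 * p) q (∣-trans (gcd[m,n]∣m (v p) (u q)) (v[n]∣u[2n] p)) (gcd[m,n]∣n (v p) (u q)))

    gcd[v[n],u[m]]∣2 : gcd (v n) (u m) ∣ 2
    gcd[v[n],u[m]]∣2 = gcd[v[p],u[q]]∣2 n≡dn′ m≡dm′ coprime m′-odd

    gcd[v[m],u[n]]∣2 : gcd (v m) (u n) ∣ 2
    gcd[v[m],u[n]]∣2 = gcd[v[p],u[q]]∣2 m≡dm′ n≡dn′ (λ (p , q) → coprime (q , p)) n′-odd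

    rank-v[m]v[n]-coprime : gcd (v n) (u m) ≡ 1 → gcd (v m) (u n) ≡ 1 →
                            RankOfApparition (v m * v n) (2 * l * g)
    rank-v[m]v[n]-coprime gcd₁≡1 gcd₂≡1 s = mk⇔
      (v[m]v[n]∣u[s]⇒2lM∣s g 1 (s≤s z≤n) (subst (_∣ v m) (sym (ℕP.*-identityʳ g)) g∣v[m])
        (subst (_∣ v n) (sym (ℕP.*-identityʳ g)) g∣v[n])
        (subst (_∣ 1) (sym gcd₁≡1) ∣-refl) (subst (_∣ 1) (sym gcd₂≡1) ∣-refl))
      (λ h → ∣-trans (∣-trans v[m]v[n]∣gv[l] (*-monoʳ-∣ g (v[n]∣u[2n] l))) (tM∣s⇒Mu[t]∣u[s] 1≤2l g∣u[2l] h))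

    rank-v[m]v[n]-even-g : ∀ g′ → g ≡ g′ * 2 → 2 ∣ u l → RankOfApparition (v m * v n) (2 * l * g′)
    rank-v[m]v[n]-even-g g′ g≡g′2 2∣u[l] s = mk⇔
      (v[m]v[n]∣u[s]⇒2lM∣s g′ 2 (s≤s z≤n) (subst (_∣ v m) g≡g′2 g∣v[m]) (subst (_∣ v n) g≡g′2 g∣v[n])
        gcd[v[n],u[m]]∣2 gcd[v[m],u[n]]∣2)
      (λ h → ∣-trans v[m]v[n]∣g′u[2l] (tM∣s⇒Mu[t]∣u[s] 1≤2l g′∣u[2l] h))
      where
      g′∣u[2l] : g′ ∣ u (2 * l)
      g′∣u[2l] = ∣-trans (divides 2 (trans g≡g′2 (ℕP.*-comm g′ 2))) g∣u[2l]
      regroup : ∀ g′ x → g′ * 2 * x ≡ g′ * (2 * x)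
      regroup = solve-∀
      v[m]v[n]∣g′u[2l] : v m * v n ∣ g′ * u (2 * l)
      v[m]v[n]∣g′u[2l] = ∣-trans v[m]v[n]∣gv[l]
        (subst₂ _∣_ (trans (sym (regroup g′ (v l))) (cong (_* v l) (sym g≡g′2))) (cong (g′ *_) (sym (u[2n]≡u[n]v[n] l)))
                    (*-monoʳ-∣ g′ (*-monoˡ-∣ (v l) 2∣u[l])))

  module _ where
    import Data.Integer.Divisibility as ℤD
    open Parity

    private
      odd⇒odd-gcd : ∀ {x y} → ¬ (2 ∣ x) ⊎ ¬ (2 ∣ y) → ¬ (2 ∣ gcd x y)
      odd⇒odd-gcd {x} {y} (inj₁ x-odd) 2∣g = x-odd (∣-trans 2∣g (gcd[m,n]∣m x y))
      odd⇒odd-gcd {x} {y} (inj₂ y-odd) 2∣g = y-odd (∣-trans 2∣g (gcd[m,n]∣n x y))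

      3∤gcd⇒3∤⊎3∤ : ∀ {x y} → ¬ (3 ∣ gcd x y) → ¬ (3 ∣ x) ⊎ ¬ (3 ∣ y)
      3∤gcd⇒3∤⊎3∤ {x} {y} 3∤g with 3 ∣? x | 3 ∣? y
      ... | no 3∤x  | _       = inj₁ 3∤x
      ... | yes _   | no 3∤y  = inj₂ 3∤y
      ... | yes 3∣x | yes 3∣y = contradiction (gcd-greatest 3∣x 3∣y) 3∤g

      odd-u∧odd-v : ∀ {k} → ¬ (+ 2 ℤD.∣ a) → ¬ (+ 2 ℤD.∣ b) → ¬ (3 ∣ k) → ¬ (2 ∣ u k) × ¬ (2 ∣ v k)
      odd-u∧odd-v {k} a-odd b-odd 3∤k = u-odd , λ 2∣v → u-odd (odd-a⇒2∣v[k]⇒2∣u[k] a-odd k 2∣v)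
        where
        u-odd : ¬ (2 ∣ u k)
        u-odd 2∣u = 3∤k (Equivalence.to (odd-a∧odd-b⇒2∣u[k]⇔3∣k a-odd b-odd k) 2∣u)

      odd-v : + 2 ℤD.∣ b → ∀ {k} → 1 ≤ k → ¬ (2 ∣ v k)
      odd-v b-even {suc k} _ = even-b⇒odd-v[1+k] b-even k

      odd-d⇒odd : ¬ (2 ∣ d) → ∀ {k k′} → k ≡ d * k′ → ¬ (2 ∣ k′) → ¬ (2 ∣ k)
      odd-d⇒odd d-odd refl k′-odd = odd*odd d-odd k′-odd

    Case-lg : Set
    Case-lg = (¬ (+ 2 ℤD.∣ b) × (+ 2 ℤD.∣ a) × (2 ∣ d))
            ⊎ (¬ (+ 2 ℤD.∣ b) × ¬ (+ 2 ℤD.∣ a) × (3 ∣ d))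
            ⊎ (¬ (+ 2 ℤD.∣ b) × (+ 2 ℤD.∣ a) × ¬ (2 ∣ d) × (ν₂ m ≢ ν₂ n))

    Case-2lg : Set
    Case-2lg = (+ 2 ℤD.∣ b)
             ⊎ (¬ (+ 2 ℤD.∣ b) × ¬ (+ 2 ℤD.∣ a) × ¬ (3 ∣ d))
             ⊎ (¬ (+ 2 ℤD.∣ b) × (+ 2 ℤD.∣ a) × ¬ (2 ∣ d) × (ν₂ m ≡ ν₂ n))

    private
      Case-lg⇒2∣v[k] : Case-lg → ∀ {k} → d ∣ k → 2 ∣ v k
      Case-lg⇒2∣v[k] (inj₁ (_ , a-even , _))             {k} _   = even-a⇒2∣v[k] a-even k
      Case-lg⇒2∣v[k] (inj₂ (inj₁ (b-odd , a-odd , 3∣d))) {k} d∣k =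
        2∣u[k]⇒2∣v[k] k (Equivalence.from (odd-a∧odd-b⇒2∣u[k]⇔3∣k a-odd b-odd k) (∣-trans 3∣d d∣k))
      Case-lg⇒2∣v[k] (inj₂ (inj₂ (_ , a-even , _)))      {k} _   = even-a⇒2∣v[k] a-even k

      Case-lg⇒2∣u[l] : Case-lg → ¬ (2 ∣ m′) → ¬ (2 ∣ n′) → 2 ∣ u l
      Case-lg⇒2∣u[l] (inj₁ (_ , a-even , 2∣d)) _ _ =
        Equivalence.from (even-a⇒2∣u[k]⇔2∣k a-even l) (∣-trans 2∣d (∣-trans d∣m m∣l))
      Case-lg⇒2∣u[l] (inj₂ (inj₁ (b-odd , a-odd , 3∣d))) _ _ =
        Equivalence.from (odd-a∧odd-b⇒2∣u[k]⇔3∣k a-odd b-odd l) (∣-trans 3∣d (∣-trans d∣m m∣l))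
      Case-lg⇒2∣u[l] (inj₂ (inj₂ (_ , _ , _ , ν₂[m]≢ν₂[n]))) m′-odd n′-odd =
        contradiction (odd-m′∧odd-n′⇒ν₂[m]≡ν₂[n] m′-odd n′-odd) ν₂[m]≢ν₂[n]

      Case-2lg⇒odd-v[m]⊎odd-v[n] : Case-2lg → (2 ∣ m′) ⊎ (2 ∣ n′) → ¬ (2 ∣ v m) ⊎ ¬ (2 ∣ v n)
      Case-2lg⇒odd-v[m]⊎odd-v[n] (inj₁ b-even) _ = inj₁ (odd-v b-even 1≤m)
      Case-2lg⇒odd-v[m]⊎odd-v[n] (inj₂ (inj₁ (b-odd , a-odd , 3∤d))) _ with 3∤gcd⇒3∤⊎3∤ {m} {n} 3∤d
      ... | inj₁ 3∤m = inj₁ (proj₂ (odd-u∧odd-v a-odd b-odd 3∤m))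
      ... | inj₂ 3∤n = inj₂ (proj₂ (odd-u∧odd-v a-odd b-odd 3∤n))
      Case-2lg⇒odd-v[m]⊎odd-v[n] (inj₂ (inj₂ (_ , _ , _ , ν₂≡))) (inj₁ m′-even) =
        contradiction m′-even (ν₂[m]≡ν₂[n]⇒odd-m′ ν₂≡)
      Case-2lg⇒odd-v[m]⊎odd-v[n] (inj₂ (inj₂ (_ , _ , _ , ν₂≡))) (inj₂ n′-even) =
        contradiction n′-even (ν₂[m]≡ν₂[n]⇒odd-n′ ν₂≡)

      Case-2lg⇒odd-v[p]⊎odd-u[q] : Case-2lg → ∀ {p q q′} → 1 ≤ p → q ≡ d * q′ → ¬ (2 ∣ q′) →
                                   (¬ (3 ∣ d) → ¬ (3 ∣ q) ⊎ ¬ (3 ∣ p)) → ¬ (2 ∣ v p) ⊎ ¬ (2 ∣ u q)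
      Case-2lg⇒odd-v[p]⊎odd-u[q] (inj₁ b-even) 1≤p _ _ _ = inj₁ (odd-v b-even 1≤p)
      Case-2lg⇒odd-v[p]⊎odd-u[q] (inj₂ (inj₁ (b-odd , a-odd , 3∤d))) _ _ _ 3∤ with 3∤ 3∤d
      ... | inj₁ 3∤q = inj₂ (proj₁ (odd-u∧odd-v a-odd b-odd 3∤q))
      ... | inj₂ 3∤p = inj₁ (proj₂ (odd-u∧odd-v a-odd b-odd 3∤p))
      Case-2lg⇒odd-v[p]⊎odd-u[q] (inj₂ (inj₂ (_ , a-even , d-odd , _))) {q = q} _ q≡ q′-odd _ =
        inj₂ (λ 2∣u[q] → odd-d⇒odd d-odd q≡ q′-odd (Equivalence.to (even-a⇒2∣u[k]⇔2∣k a-even q) 2∣u[q]))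

    rank-v[m]v[n]-lg : Case-lg → RankOfApparition (v m * v n) (l * g)
    rank-v[m]v[n]-lg H = by-cofactors (2 ∣? m′) (2 ∣? n′)
      where
      2∣g : 2 ∣ g
      2∣g = gcd-greatest (Case-lg⇒2∣v[k] H d∣m) (Case-lg⇒2∣v[k] H d∣n)
      from-one-even : (2 ∣ m′) ⊎ (2 ∣ n′) → RankOfApparition (v m * v n) (l * g)
      from-one-even cofactor-even = rank-resp-≡
        (trans (ℕP.*-comm 2 l) (cong (l *_) (sym (∣2∧even⇒≡2 (proj₂ (rank-v[m]v[n]-one-even cofactor-even)) 2∣g))))
        (proj₁ (rank-v[m]v[n]-one-even cofactor-even))
      by-cofactors : Dec (2 ∣ m′) → Dec (2 ∣ n′) → RankOfApparition (v m * v n) (l * g)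
      by-cofactors (yes m′-even) _           = from-one-even (inj₁ m′-even)
      by-cofactors (no _)       (yes n′-even) = from-one-even (inj₂ n′-even)
      by-cofactors (no m′-odd)  (no n′-odd)  = rank-resp-≡ (trans (regroup l g′) (cong (l *_) (sym g≡g′2)))
        (BothCofactorsOdd.rank-v[m]v[n]-even-g m′-odd n′-odd g′ g≡g′2 (Case-lg⇒2∣u[l] H m′-odd n′-odd))
        where
        g′ = quotient 2∣g
        g≡g′2 : g ≡ g′ * 2
        g≡g′2 = m∣n⇒n≡quotient*m 2∣g
        regroup : ∀ l g′ → 2 * l * g′ ≡ l * (g′ * 2)
        regroup = solve-∀

    rank-v[m]v[n]-2lg : Case-2lg → RankOfApparition (v m * v n) (2 * l * g)
    rank-v[m]v[n]-2lg J = by-cofactors (2 ∣? m′) (2 ∣? n′)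
      where
      from-one-even : (2 ∣ m′) ⊎ (2 ∣ n′) → RankOfApparition (v m * v n) (2 * l * g)
      from-one-even cofactor-even = rank-resp-≡
        (sym (trans (cong (2 * l *_) (∣2∧odd⇒≡1 (proj₂ (rank-v[m]v[n]-one-even cofactor-even))
                                                (odd⇒odd-gcd (Case-2lg⇒odd-v[m]⊎odd-v[n] J cofactor-even))))
                    (ℕP.*-identityʳ (2 * l))))
        (proj₁ (rank-v[m]v[n]-one-even cofactor-even))
      by-cofactors : Dec (2 ∣ m′) → Dec (2 ∣ n′) → RankOfApparition (v m * v n) (2 * l * g)
      by-cofactors (yes m′-even) _           = from-one-even (inj₁ m′-even)
      by-cofactors (no _)       (yes n′-even) = from-one-even (inj₂ n′-even)
      by-cofactors (no m′-odd) (no n′-odd) = BothCofactorsOdd.rank-v[m]v[n]-coprime m′-odd n′-odd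
        (∣2∧odd⇒≡1 (BothCofactorsOdd.gcd[v[n],u[m]]∣2 m′-odd n′-odd)
                   (odd⇒odd-gcd (Case-2lg⇒odd-v[p]⊎odd-u[q] J 1≤n m≡dm′ m′-odd (3∤gcd⇒3∤⊎3∤ {m} {n}))))
        (∣2∧odd⇒≡1 (BothCofactorsOdd.gcd[v[m],u[n]]∣2 m′-odd n′-odd)
                   (odd⇒odd-gcd (Case-2lg⇒odd-v[p]⊎odd-u[q] J 1≤m n≡dn′ n′-odd (swap ∘ 3∤gcd⇒3∤⊎3∤ {m} {n}))))

-- The notation of the statement; its _*_, _>_ and _∣_ are the integer ones, which would
-- clash with the natural-number operations opened in the modules above.
open import Data.Nat.GCD using (gcd)
import Data.Nat.Divisibility as ℕD
open import Data.Nat.LCM using (lcm)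
open import Data.Integer as ℤ using (ℤ; +_; _*_; _>_)
open import Data.Integer.Divisibility using (_∣_)
open import Data.Integer.Coprimality using (Coprime)
import Data.Integer.GCD as ℤG

theorem1p1 : (a b : ℤ) → Coprime a b → NonDegenerate a b → a > + 0 → Δ a b > + 0 →
    (m n : ℕ) → m ℕ.≥ 3 → n ℕ.≥ 3 →
    ((ν₂ m ℕ.≤ ν₂ n → τ≡ a b (U a b m * V a b n) (+ 2 * + lcm m n))
     × (ν₂ m ℕ.> ν₂ n → τ≡ a b (U a b m * V a b n) (+ lcm m n * V a b (gcd m n))))
    × τ≡ a b (U a b m * U a b n) (+ lcm m n * U a b (gcd m n))
    × (((¬ (+ 2 ∣ b) × (+ 2 ∣ a) × (2 ℕD.∣ gcd m n))
        ⊎ (¬ (+ 2 ∣ b) × ¬ (+ 2 ∣ a) × (3 ℕD.∣ gcd m n))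
        ⊎ (¬ (+ 2 ∣ b) × (+ 2 ∣ a) × ¬ (2 ℕD.∣ gcd m n) × (ν₂ m ≢ ν₂ n))
        → τ≡ a b (V a b m * V a b n) (+ lcm m n * ℤG.gcd (V a b m) (V a b n)))
     × (((+ 2 ∣ b)
        ⊎ (¬ (+ 2 ∣ b) × ¬ (+ 2 ∣ a) × ¬ (3 ℕD.∣ gcd m n))
        ⊎ (¬ (+ 2 ∣ b) × (+ 2 ∣ a) × ¬ (2 ℕD.∣ gcd m n) × (ν₂ m ≡ ν₂ n)))
        → τ≡ a b (V a b m * V a b n) (+ 2 * + lcm m n * ℤG.gcd (V a b m) (V a b n))))
theorem1p1 (+ zero)    _ _   _         (ℤ.+<+ ()) _   _ _ _   _
theorem1p1 -[1+ _ ]    _ _   _         ()         _   _ _ _   _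
theorem1p1 a@(+ suc A) b a⊥b (b≢0 , _) _          Δ>0 m n 3≤m 3≤n =
    ( (λ ν₂[m]≤ν₂[n] → τ≡-of (U a b m) (V a b n) (1≤* {2} (s≤s z≤n) 1≤l)
                         (rank-u[m]v[n]-ν₂[m]≤ν₂[n] ν₂[m]≤ν₂[n]) (ℤP.pos-* 2 l))
    , (λ ν₂[n]<ν₂[m] → τ≡-of (U a b m) (V a b n) (1≤* 1≤l (v-positive d))
                         (rank-u[m]v[n]-ν₂[n]<ν₂[m] ν₂[n]<ν₂[m])
                         (trans (ℤP.pos-* l (v d)) (cong (+ l *_) (sym (V≡+v d))))))
  , τ≡-of (U a b m) (U a b n) (1≤* 1≤l (u-positive 1≤d)) rank-u[m]u[n]
      (trans (ℤP.pos-* l (u d)) (cong (+ l *_) (sym (U≡+u d))))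
  , (λ H → τ≡-of (V a b m) (V a b n) (1≤* 1≤l 1≤g) (rank-v[m]v[n]-lg H) (ℤP.pos-* l g))
  , (λ J → τ≡-of (V a b m) (V a b n) (1≤* (1≤* {2} (s≤s z≤n) 1≤l) 1≤g) (rank-v[m]v[n]-2lg J)
             (trans (ℤP.pos-* (2 ℕ.* l) g) (cong (_* + g) (ℤP.pos-* 2 l))))
  where
  G = LucasGrowth.lucas-growth A b b≢0 Δ>0
  open PositiveLucas a b a⊥b G
  open OrdersOfAppearance a b a⊥b G m n 3≤m 3≤n
  open NatDivisibility using (1≤*; gcd-positive)
  τ≡-of : ∀ X Y {T E} → 1 ℕ.≤ T → RankOfApparition (∣ X ∣ ℕ.* ∣ Y ∣) T → + T ≡ E → τ≡ a b (X * Y) E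
  τ≡-of X Y = rank⇒τ≡ (X * Y) (ℤP.abs-* X Y)
  1≤g : 1 ℕ.≤ g
  1≤g = gcd-positive (v m) (v n) (v-positive m)
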